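{- Let $q=2mn+1$ be a prime power, where $m,n$ are odd and coprime positive integers. Let $\xi\in\mathbb{F}_q^*$ have order $n$, $\epsilon\in\mathbb{F}_q^*$ have order $m$, let $A_{m,n}=(a_{i,j})$ be the $m\times n$ array with $a_{i,j}=\epsilon^{i-1}\xi^{j-1}$, and let $\Pi_{m,n}$ be the Archdeacon embedding of $K_q$ induced by $A_{m,n}$ with the natural orderings $\omega_r$ (rows left to right) and $\omega_c$ (columns top to bottom). Then the group $\mathrm{Aut}_0(\Pi_{m,n})$ of automorphisms of $\Pi_{m,n}$ fixing $0$ is isomorphic to $\mathbb{Z}_{mn}$, the full automorphism group satisfies $|\mathrm{Aut}(\Pi_{m,n})|=\binom{2mn+1}{2}$, and the faces of $\Pi_{m,n}$ are simple cycles of length $m$ and $n$.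
   Context: $A_{m,n}$ is a Heffter array over the additive group of $\mathbb{F}_q$ (every row and column sums to $0$, and $\{\pm x\}$ over entries $x$ covers $\mathbb{F}_q\setminus\{0\}$ exactly once), and the natural orderings are compatible. Here $\omega_r(a_{i,j})=a_{i,j+1}$, $\omega_c(a_{i,j})=a_{i+1,j}$ (indices modulo $n$ and $m$ respectively); writing $\mathcal{E}(A)$ for the set of entries, $\rho_0$ is the permutation of $\mathbb{F}_q\setminus\{0\}$ with $\rho_0(a)=-\omega_r(a)$ for $a\in\mathcal{E}(A)$ and $\rho_0(a)=\omega_c(-a)$ for $a\in-\mathcal{E}(A)$, and $\Pi_{m,n}=(K_q,\rho)$ where $K_q$ has vertex set $\mathbb{F}_q$ and $\rho((x,x+a))=(x,x+\rho_0(a))$ on oriented edges. Faces are the boundary walks given by the orbits of $(x,y)\mapsto(y,\rho_y(x))$ on oriented edges, where $\rho(y,z)=(y,\rho_y(z))$. An automorphism of $\Pi_{m,n}$ is a graph automorphism $\sigma$ of $K_q$ with either $\sigma\circ\rho=\rho\circ\sigma$ or $\sigma\circ\rho=\rho^{ -1}\circ\sigma$ on all oriented edges; $\mathrm{Aut}(\Pi_{m,n})$ is the group of all such automorphisms. -}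

module Defs where

open import Level using (0ℓ)
open import Data.Nat as ℕ using (ℕ; zero; suc; _<_)
open import Data.Fin as Fin using (Fin; toℕ; fromℕ<)
open import Data.Fin.Properties using (any?)
open import Data.Product using (Σ; ∃; _×_; _,_; proj₁; proj₂)
open import Data.Sum using (_⊎_)
open import Data.Bool using (Bool; true; false)
open import Relation.Nullary using (¬_; yes; no)
open import Relation.Binary.PropositionalEquality using (_≡_; _≢_)
open import Relation.Binary.Definitions using (DecidableEquality)
open import Algebra.Structures using (IsCommutativeRing)
open import Function.Bundles using (_↔_)
open import Function.Definitions using (Bijective)

Odd : ℕ → Set
Odd k = ∃ λ t → k ≡ suc (2 ℕ.* t)

record FiniteField : Set₁ where
  infixl 7 _*_
  infixl 6 _+_
  field
    F      : Set
    _≟_    : DecidableEquality F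
    _+_    : F → F → F
    _*_    : F → F → F
    -_     : F → F
    0#     : F
    1#     : F
    isCommutativeRing : IsCommutativeRing _≡_ _+_ _*_ -_ 0# 1#
    0≢1    : 0# ≢ 1#
    inv    : ∀ x → x ≢ 0# → ∃ λ y → x * y ≡ 1#
    size   : ℕ
    enum   : F ↔ Fin size

  _^_ : F → ℕ → F
  x ^ zero  = 1#
  x ^ suc k = x * (x ^ k)

  HasOrder : F → ℕ → Set
  HasOrder x k = 0 < k × (x ^ k ≡ 1#) × (∀ j → 0 < j → j < k → x ^ j ≢ 1#)

  sumFin : ∀ k → (Fin k → F) → F
  sumFin zero    f = 0#
  sumFin (suc k) f = f Fin.zero + sumFin k (λ i → f (Fin.suc i))

nextFin : ∀ {k} → Fin k → Fin k
nextFin {suc k} i with suc (toℕ i) ℕ.<? suc k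
... | yes p = fromℕ< p
... | no _  = Fin.zero

module Embedding (K : FiniteField) where
  open FiniteField K

  -- the array A_{m,n}: a_{i,j} = ε^{i-1} ξ^{j-1} (here 0-indexed)
  arrayA : ∀ {m n} → F → F → Fin m → Fin n → F
  arrayA ε ξ i j = (ε ^ toℕ i) * (ξ ^ toℕ j)

  signed : Bool → F → F
  signed true  x = x
  signed false x = - x

  IsHeffter : ∀ m n → (Fin m → Fin n → F) → Set
  IsHeffter m n a =
      (∀ i → sumFin n (λ j → a i j) ≡ 0#)
    × (∀ j → sumFin m (λ i → a i j) ≡ 0#)
    × (∀ i j → a i j ≢ 0#)
    × (∀ x → x ≢ 0# → ∃ λ i → ∃ λ j → ∃ λ s → signed s (a i j) ≡ x)
    × (∀ i j s i' j' s' → signed s (a i j) ≡ signed s' (a i' j')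
         → (i ≡ i') × (j ≡ j') × (s ≡ s'))

  -- the permutation ρ₀ of F∖{0} given by the natural orderings:
  --   ρ₀(a) = - ω_r(a)  for a ∈ E(A),   ω_r(a_{i,j}) = a_{i,j+1}
  --   ρ₀(a) = ω_c(-a)   for a ∈ -E(A),  ω_c(a_{i,j}) = a_{i+1,j}
  -- (indices mod n, m).  The value on 0 is irrelevant (set to 0).
  rho0 : ∀ m n → (Fin m → Fin n → F) → F → F
  rho0 m n a x with any? (λ i → any? (λ j → a i j ≟ x))
  ... | yes (i , j , _) = - a i (nextFin j)
  ... | no _ with any? (λ i → any? (λ j → a i j ≟ (- x)))
  ...   | yes (i , j , _) = a (nextFin i) j
  ...   | no _ = x

  -- local rotation at vertex v of K_q:  ρ((v, v + d)) = (v, v + ρ₀(d))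
  rot : ∀ m n → (Fin m → Fin n → F) → F → F → F
  rot m n a v w = v + rho0 m n a (w + (- v))

  faceStep : ∀ m n → (Fin m → Fin n → F) → F × F → F × F
  faceStep m n a (x , y) = (y , rot m n a y x)

  iter : ∀ {A : Set} → (A → A) → ℕ → A → A
  iter f zero    x = x
  iter f (suc k) x = f (iter f k x)

  FaceIsSimpleCycleOfLength : ∀ m n → (Fin m → Fin n → F) → F × F → ℕ → Set
  FaceIsSimpleCycleOfLength m n a d k =
      iter (faceStep m n a) k d ≡ d
    × (∀ i j → i < j → j < k →
         proj₁ (iter (faceStep m n a) i d) ≢ proj₁ (iter (faceStep m n a) j d))

  -- automorphisms of Π = (K_q, ρ): a permutation σ of the vertices (every
  -- permutation is a graph automorphism of K_q) with σ∘ρ = ρ∘σ or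
  -- σ∘ρ = ρ⁻¹∘σ on all oriented edges (the latter written as ρ∘σ∘ρ = σ).
  IsAut : ∀ m n → (Fin m → Fin n → F) → (F → F) → Set
  IsAut m n a σ =
      Bijective _≡_ _≡_ σ
    × ( (∀ x y → x ≢ y → σ (rot m n a x y) ≡ rot m n a (σ x) (σ y))
      ⊎ (∀ x y → x ≢ y → rot m n a (σ x) (σ (rot m n a x y)) ≡ σ y))

  IsAut₀ : ∀ m n → (Fin m → Fin n → F) → (F → F) → Set
  IsAut₀ m n a σ = IsAut m n a σ × σ 0# ≡ 0#

  _≐_ : (F → F) → (F → F) → Set
  σ ≐ τ = ∀ x → σ x ≡ τ x

  -- the group of permutations σ of F satisfying P (group law: composition,
  -- equality: pointwise) is isomorphic to ℤ_N: a bijection φ : ℤ_N → {σ | P σ}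
  -- with φ(i + j mod N) = φ i ∘ φ j.
  record CyclicIso (N : ℕ) (P : (F → F) → Set) : Set where
    field
      φ    : Fin N → F → F
      φ∈   : ∀ i → P (φ i)
      hom  : ∀ i j k → (toℕ i ℕ.+ toℕ j ≡ toℕ k) ⊎ (toℕ i ℕ.+ toℕ j ≡ toℕ k ℕ.+ N)
               → φ k ≐ (λ x → φ i (φ j x))
      inj  : ∀ i j → φ i ≐ φ j → i ≡ j
      surj : ∀ σ → P σ → ∃ λ i → φ i ≐ σ

  record HasCard (P : (F → F) → Set) (N : ℕ) : Set where
    field
      e    : Fin N → F → F
      e∈   : ∀ i → P (e i)
      inj  : ∀ i j → e i ≐ e j → i ≡ j
      surj : ∀ σ → P σ → ∃ λ i → e i ≐ σ

-- Every x ≢ 0 is ± ε^i ξ^j, and ρ₀ acts as x ↦ -ξx on E(A) and as x ↦ -εx on -E(A). Hence ρ₀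
-- commutes with multiplication by g = εξ, whose powers are the mn elements ε^i ξ^j (m, n coprime),
-- and the q·mn = C(q,2) maps x ↦ g^k x + t are automorphisms. The face through a dart (x, x ± ε^i ξ^j)
-- has vertices x ± ε^i ξ^j (1 + h + ⋯ + h^(k-1)) with h = ε resp. ξ, a simple cycle of length m resp. n
-- since the columns and rows of A sum to 0. Conversely, composing an automorphism with an affine map
-- gives τ with τ 0 = 0 and τ 1 = ± 1. If τ preserves ρ and τ 1 = 1 then τ is the identity, because the
-- ρ₀-orbit of 1 is all of F ∖ {0}. The other three cases are impossible: a ρ-preserving τ with τ 1 = -1
-- or a ρ-reversing τ with τ 1 = 1 would carry a face of length m to one of length n, and a ρ-reversing
-- τ with τ 1 = -1 satisfies x τ(x) = -1 on F ∖ {0}, which forces ε³ = ξ³ = 1 and so m = n = 3.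

{-# OPTIONS --safe #-}
module Submission where

open import Algebra.Bundles using (CommutativeRing)
open import Algebra.Solver.Ring.AlmostCommutativeRing using (fromCommutativeRing; _-Raw-AlmostCommutative⟶_)
open import Data.Bool using (Bool; true; false)
open import Data.Empty using (⊥-elim)
open import Data.Fin as Fin using (Fin; toℕ; fromℕ<)
import Data.Fin.Properties as Fin
open import Data.Integer as ℤ using (ℤ; -[1+_]; _⊖_; 0ℤ; 1ℤ)
import Data.Integer.Properties as ℤ
import Data.Maybe
open import Data.Nat as ℕ using (ℕ; zero; suc; z≤n; s≤s)
import Data.Nat.Properties as ℕ
open import Data.Nat.Coprimality as Coprimality using (Coprime; coprime-Bézout; coprime⇒gcd≡1)
open import Data.Nat.Divisibility using (_∣_; ∣-refl; ∣⇒≤; m%n≡0⇒n∣m)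
open import Data.Nat.DivMod using (_%_; _/_; _mod_; m%n<n; m≡m%n+[m/n]*n; m<n⇒m%n≡m)
open import Data.Nat.GCD using (gcd; module Bézout)
open import Data.Nat.LCM using (lcm; lcm-least; gcd*lcm)
open import Data.Product using (∃; _×_; _,_; proj₁; proj₂; map; swap)
open import Data.Product.Function.NonDependent.Propositional using (_×-↔_)
open import Data.Sign as Sign using (Sign)
open import Data.Sum using (_⊎_; inj₁; inj₂)
open import Function.Bundles using (_↔_; Inverse)
open import Function.Definitions using (Bijective)
open import Function.Properties.Inverse using (↔-refl; ↔-sym; ↔-trans)
open import Level using (0ℓ)
open import Relation.Binary.PropositionalEquality
  using (_≡_; _≢_; refl; sym; trans; cong; cong₂; subst; module ≡-Reasoning)
open import Relation.Nullary using (¬_; yes; no)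
open import Relation.Nullary.Decidable using (dec⇒maybe)

open import Defs

module IntegerCoefficients {c ℓ} (R : CommutativeRing c ℓ) where
  open CommutativeRing R renaming (refl to ≈-refl; sym to ≈-sym; trans to ≈-trans)
  open import Algebra.Properties.Ring ring using (-‿involutive; -0#≈0#; -‿distribˡ-*)
  open import Algebra.Properties.AbelianGroup +-abelianGroup using (⁻¹-∙-comm)
  open import Algebra.Properties.Semiring.Mult.TCOptimised semiring using (×-homo-+; ×1-homo-*; 1+×)
    renaming (_×_ to _·_)
  open import Relation.Binary.Reasoning.Setoid setoid

  ⟦_⟧ℤ : ℤ → Carrier
  ⟦ ℤ.+ k ⟧ℤ = k · 1#
  ⟦ -[1+ k ] ⟧ℤ = - (suc k · 1#)

  private
    signValue : Sign → Carrier
    signValue Sign.+ = 1#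
    signValue Sign.- = - 1#

    signValue-* : ∀ s t → signValue (s Sign.* t) ≈ signValue s * signValue t
    signValue-* Sign.+ t = ≈-sym (*-identityˡ _)
    signValue-* Sign.- Sign.+ = ≈-sym (*-identityʳ _)
    signValue-* Sign.- Sign.- = begin
      1#              ≈⟨ ≈-sym (-‿involutive 1#) ⟩
      - - 1#          ≈⟨ -‿cong (≈-sym (*-identityˡ (- 1#))) ⟩
      - (1# * - 1#)   ≈⟨ -‿distribˡ-* 1# (- 1#) ⟩
      - 1# * - 1#     ∎

    ◃-hom : ∀ s k → ⟦ s ℤ.◃ k ⟧ℤ ≈ signValue s * (k · 1#)
    ◃-hom s zero = ≈-sym (zeroʳ _)
    ◃-hom Sign.+ (suc k) = ≈-sym (*-identityˡ _)
    ◃-hom Sign.- (suc k) = ≈-trans (-‿cong (≈-sym (*-identityˡ _))) (-‿distribˡ-* 1# _)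

    sign-abs : ∀ i → ⟦ i ⟧ℤ ≈ signValue (ℤ.sign i) * (ℤ.∣ i ∣ · 1#)
    sign-abs i = ≈-trans (reflexive (cong ⟦_⟧ℤ (sym (ℤ.◃-inverse i)))) (◃-hom (ℤ.sign i) ℤ.∣ i ∣)

    shift : ∀ x y → x - y ≈ (1# + x) - (1# + y)
    shift x y = begin
      x - y                     ≈⟨ ≈-sym (+-identityˡ _) ⟩
      0# + (x - y)              ≈⟨ +-congʳ (≈-sym (-‿inverseʳ 1#)) ⟩
      (1# - 1#) + (x - y)       ≈⟨ +-assoc 1# (- 1#) _ ⟩
      1# + (- 1# + (x - y))     ≈⟨ +-congˡ (≈-sym (+-assoc (- 1#) x _)) ⟩
      1# + ((- 1# + x) - y)     ≈⟨ +-congˡ (+-congʳ (+-comm (- 1#) x)) ⟩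
      1# + ((x - 1#) - y)       ≈⟨ +-congˡ (+-assoc x (- 1#) _) ⟩
      1# + (x + (- 1# - y))     ≈⟨ ≈-sym (+-assoc 1# x _) ⟩
      (1# + x) + (- 1# - y)     ≈⟨ +-congˡ (⁻¹-∙-comm 1# y) ⟩
      (1# + x) - (1# + y)       ∎

    ⊖-hom : ∀ a b → ⟦ a ⊖ b ⟧ℤ ≈ a · 1# - b · 1#
    ⊖-hom a zero = ≈-trans (reflexive (cong ⟦_⟧ℤ (ℤ.⊖-≥ {a} ℕ.z≤n)))
                         (≈-sym (≈-trans (+-congˡ -0#≈0#) (+-identityʳ _)))
    ⊖-hom zero (suc b) = ≈-trans (reflexive (cong ⟦_⟧ℤ (ℤ.⊖-< {0} {suc b} ℕ.z<s))) (≈-sym (+-identityˡ _))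
    ⊖-hom (suc a) (suc b) = begin
      ⟦ suc a ⊖ suc b ⟧ℤ        ≡⟨ cong ⟦_⟧ℤ (ℤ.[1+m]⊖[1+n]≡m⊖n a b) ⟩
      ⟦ a ⊖ b ⟧ℤ                ≈⟨ ⊖-hom a b ⟩
      a · 1# - b · 1#           ≈⟨ shift (a · 1#) (b · 1#) ⟩
      (1# + a · 1#) - (1# + b · 1#) ≈⟨ ≈-sym (+-cong (1+× a 1#) (-‿cong (1+× b 1#))) ⟩
      suc a · 1# - suc b · 1#   ∎

  +-hom : ∀ i j → ⟦ i ℤ.+ j ⟧ℤ ≈ ⟦ i ⟧ℤ + ⟦ j ⟧ℤ
  +-hom (ℤ.+ a) (ℤ.+ b) = ×-homo-+ 1# a b
  +-hom (ℤ.+ a) -[1+ b ] = ⊖-hom a (suc b)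
  +-hom -[1+ a ] (ℤ.+ b) = ≈-trans (⊖-hom b (suc a)) (+-comm _ _)
  +-hom -[1+ a ] -[1+ b ] = begin
    - (suc (suc (a ℕ.+ b)) · 1#)      ≡⟨ cong (λ k → - (suc k · 1#)) (sym (ℕ.+-suc a b)) ⟩
    - ((suc a ℕ.+ suc b) · 1#)        ≈⟨ -‿cong (×-homo-+ 1# (suc a) (suc b)) ⟩
    - (suc a · 1# + suc b · 1#)       ≈⟨ ≈-sym (⁻¹-∙-comm _ _) ⟩
    - (suc a · 1#) - (suc b · 1#)     ∎

  *-hom : ∀ i j → ⟦ i ℤ.* j ⟧ℤ ≈ ⟦ i ⟧ℤ * ⟦ j ⟧ℤ
  *-hom i j = begin
    ⟦ i ℤ.* j ⟧ℤ                                    ≈⟨ ◃-hom (s Sign.* t) (a ℕ.* b) ⟩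
    signValue (s Sign.* t) * ((a ℕ.* b) · 1#)       ≈⟨ *-cong (signValue-* s t) (×1-homo-* a b) ⟩
    (signValue s * signValue t) * (a · 1# * b · 1#) ≈⟨ interchange _ _ _ _ ⟩
    (signValue s * a · 1#) * (signValue t * b · 1#) ≈⟨ ≈-sym (*-cong (sign-abs i) (sign-abs j)) ⟩
    ⟦ i ⟧ℤ * ⟦ j ⟧ℤ                                 ∎
    where
    s = ℤ.sign i
    t = ℤ.sign j
    a = ℤ.∣ i ∣
    b = ℤ.∣ j ∣
    interchange : ∀ w x y z → (w * x) * (y * z) ≈ (w * y) * (x * z)
    interchange w x y z = begin
      (w * x) * (y * z)   ≈⟨ *-assoc w x _ ⟩
      w * (x * (y * z))   ≈⟨ *-congˡ (≈-sym (*-assoc x y z)) ⟩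
      w * ((x * y) * z)   ≈⟨ *-congˡ (*-congʳ (*-comm x y)) ⟩
      w * ((y * x) * z)   ≈⟨ *-congˡ (*-assoc y x z) ⟩
      w * (y * (x * z))   ≈⟨ ≈-sym (*-assoc w y _) ⟩
      (w * y) * (x * z)   ∎

  neg-hom : ∀ i → ⟦ ℤ.- i ⟧ℤ ≈ - ⟦ i ⟧ℤ
  neg-hom (ℤ.+ zero) = ≈-sym -0#≈0#
  neg-hom (ℤ.+ suc k) = ≈-refl
  neg-hom -[1+ k ] = ≈-sym (-‿involutive _)

  homomorphism : ℤ.+-*-rawRing -Raw-AlmostCommutative⟶ fromCommutativeRing R
  homomorphism = record
    { ⟦_⟧ = ⟦_⟧ℤ ; +-homo = +-hom ; *-homo = *-hom ; -‿homo = neg-hom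
    ; 0-homo = ≈-refl ; 1-homo = ≈-refl }

  open import Algebra.Solver.Ring ℤ.+-*-rawRing (fromCommutativeRing R) homomorphism
    (λ i j → Data.Maybe.map (λ i≡j → reflexive (cong ⟦_⟧ℤ i≡j)) (dec⇒maybe (i ℤ.≟ j)))
    public

module BinomialTwo where
  open import Data.Nat using (_*_; _+_)
  open import Data.Nat.Combinatorics using (_C_; nC1≡n; nCk+nC[k+1]≡[n+1]C[k+1])
  open import Data.Nat.Solver using (module +-*-Solver)
  open +-*-Solver
  open ≡-Reasoning

  [nC2]*2+n≡n*n : ∀ n → (n C 2) * 2 + n ≡ n * n
  [nC2]*2+n≡n*n zero = refl
  [nC2]*2+n≡n*n (suc n) = begin
    (suc n C 2) * 2 + suc n         ≡⟨ cong (λ c → c * 2 + suc n) (sym pascal) ⟩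
    (n + n C 2) * 2 + suc n         ≡⟨ regroup n (n C 2) ⟩
    ((n C 2) * 2 + n) + (n * 2 + 1) ≡⟨ cong (_+ (n * 2 + 1)) ([nC2]*2+n≡n*n n) ⟩
    n * n + (n * 2 + 1)             ≡⟨ square n ⟩
    suc n * suc n                   ∎
    where
    pascal : n + n C 2 ≡ suc n C 2
    pascal = trans (cong (_+ n C 2) (sym (nC1≡n n))) (nCk+nC[k+1]≡[n+1]C[k+1] n 1)
    regroup : ∀ n c → (n + c) * 2 + suc n ≡ (c * 2 + n) + (n * 2 + 1)
    regroup = solve 2 (λ n c → (n :+ c) :* con 2 :+ (con 1 :+ n) := (c :* con 2 :+ n) :+ (n :* con 2 :+ con 1)) refl
    square : ∀ n → n * n + (n * 2 + 1) ≡ suc n * suc n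
    square = solve 1 (λ n → n :* n :+ (n :* con 2 :+ con 1) := (con 1 :+ n) :* (con 1 :+ n)) refl

  [1+2x]C2 : ∀ x → suc (2 * x) C 2 ≡ suc (2 * x) * x
  [1+2x]C2 x = ℕ.*-cancelʳ-≡ _ _ 2 (ℕ.+-cancelʳ-≡ q _ _ (begin
    (q C 2) * 2 + q     ≡⟨ [nC2]*2+n≡n*n q ⟩
    q * q               ≡⟨ solve 1 (λ x → (con 1 :+ con 2 :* x) :* (con 1 :+ con 2 :* x)
                               := ((con 1 :+ con 2 :* x) :* x) :* con 2 :+ (con 1 :+ con 2 :* x)) refl x ⟩
    q * x * 2 + q       ∎))
    where q = suc (2 * x)

coprime⇒lcm≡* : ∀ {m n} → Coprime m n → lcm m n ≡ m ℕ.* n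
coprime⇒lcm≡* {m} {n} coprime = begin
  lcm m n            ≡⟨ sym (ℕ.*-identityˡ _) ⟩
  1 ℕ.* lcm m n      ≡⟨ cong (ℕ._* lcm m n) (sym (coprime⇒gcd≡1 coprime)) ⟩
  gcd m n ℕ.* lcm m n ≡⟨ gcd*lcm m n ⟩
  m ℕ.* n            ∎
  where open ≡-Reasoning

mod≡0⇒∣ : ∀ {d M} .{{_ : ℕ.NonZero M}} → d mod M ≡ 0 mod M → M ∣ d
mod≡0⇒∣ {d} {M} eq = m%n≡0⇒n∣m d M (begin
  d % M                  ≡⟨ sym (Fin.toℕ-fromℕ< _) ⟩
  toℕ (d mod M)          ≡⟨ cong toℕ eq ⟩
  toℕ (0 mod M)          ≡⟨ Fin.toℕ-fromℕ< _ ⟩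
  0 % M                  ≡⟨ m<n⇒m%n≡m (ℕ.>-nonZero⁻¹ M) ⟩
  0                      ∎)
  where open ≡-Reasoning

module FieldProperties (K : FiniteField) where
  open FiniteField K public

  commutativeRing : CommutativeRing 0ℓ 0ℓ
  commutativeRing = record { isCommutativeRing = isCommutativeRing }

  open CommutativeRing commutativeRing public
    using (_-_; +-assoc; +-comm; *-assoc; *-comm; +-identityˡ; +-identityʳ; *-identityˡ; *-identityʳ;
           distribˡ; -‿inverseʳ; zeroˡ; zeroʳ)
  open import Algebra.Properties.Ring (CommutativeRing.ring commutativeRing) public
    using (-‿involutive; -0#≈0#; -‿distribˡ-*; -‿distribʳ-*)
  open IntegerCoefficients commutativeRing public using (solve; _:=_; _:+_; _:*_; :-_; _:-_; con)
  open ≡-Reasoning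

  -‿injective : ∀ {x y} → - x ≡ - y → x ≡ y
  -‿injective {x} {y} p = trans (sym (-‿involutive x)) (trans (cong -_ p) (-‿involutive y))

  +-cancelˡ : ∀ x {y z} → x + y ≡ x + z → y ≡ z
  +-cancelˡ x {y} {z} p = begin
    y             ≡⟨ solve 2 (λ x y → y := (x :+ y) :- x) refl x y ⟩
    (x + y) - x   ≡⟨ cong (_- x) p ⟩
    (x + z) - x   ≡⟨ solve 2 (λ x z → (x :+ z) :- x := z) refl x z ⟩
    z             ∎

  +-cancelʳ : ∀ x {y z} → y + x ≡ z + x → y ≡ z
  +-cancelʳ x {y} {z} p = +-cancelˡ x (trans (+-comm x y) (trans p (+-comm z x)))

  1≢0 : 1# ≢ 0#
  1≢0 1≡0 = 0≢1 (sym 1≡0)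

  -1≢0 : - 1# ≢ 0#
  -1≢0 -1≡0 = 1≢0 (-‿injective (trans -1≡0 (sym -0#≈0#)))

  x+[y-x]≡y : ∀ x y → x + (y - x) ≡ y
  x+[y-x]≡y = solve 2 (λ x y → x :+ (y :- x) := y) refl

  *-inverse-unique : ∀ {x y z} → x * y ≡ 1# → y * z ≡ 1# → x ≡ z
  *-inverse-unique {x} {y} {z} xy yz = begin
    x             ≡⟨ sym (*-identityʳ x) ⟩
    x * 1#        ≡⟨ cong (x *_) (sym yz) ⟩
    x * (y * z)   ≡⟨ sym (*-assoc x y z) ⟩
    (x * y) * z   ≡⟨ cong (_* z) xy ⟩
    1# * z        ≡⟨ *-identityˡ z ⟩
    z             ∎

  *-cancelˡ : ∀ {x} y {z} → x ≢ 0# → x * y ≡ x * z → y ≡ z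
  *-cancelˡ {x} y {z} x≢0 p = trans (sym (undo y)) (trans (cong (x⁻¹ *_) p) (undo z))
    where
    x⁻¹ = proj₁ (inv x x≢0)
    undo : ∀ w → x⁻¹ * (x * w) ≡ w
    undo w = begin
      x⁻¹ * (x * w)   ≡⟨ sym (*-assoc x⁻¹ x w) ⟩
      (x⁻¹ * x) * w   ≡⟨ cong (_* w) (trans (*-comm x⁻¹ x) (proj₂ (inv x x≢0))) ⟩
      1# * w          ≡⟨ *-identityˡ w ⟩
      w               ∎

  ^-distribˡ-+-* : ∀ x a b → x ^ (a ℕ.+ b) ≡ x ^ a * x ^ b
  ^-distribˡ-+-* x zero b = sym (*-identityˡ _)
  ^-distribˡ-+-* x (suc a) b = trans (cong (x *_) (^-distribˡ-+-* x a b)) (sym (*-assoc _ _ _))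

  ^-*-assoc : ∀ x a b → (x ^ a) ^ b ≡ x ^ (a ℕ.* b)
  ^-*-assoc x a zero = cong (x ^_) (sym (ℕ.*-zeroʳ a))
  ^-*-assoc x a (suc b) = begin
    x ^ a * (x ^ a) ^ b      ≡⟨ cong (x ^ a *_) (^-*-assoc x a b) ⟩
    x ^ a * x ^ (a ℕ.* b)    ≡⟨ sym (^-distribˡ-+-* x a (a ℕ.* b)) ⟩
    x ^ (a ℕ.+ a ℕ.* b)      ≡⟨ cong (x ^_) (sym (ℕ.*-suc a b)) ⟩
    x ^ (a ℕ.* suc b)        ∎

  1^k≡1 : ∀ k → 1# ^ k ≡ 1#
  1^k≡1 zero = refl
  1^k≡1 (suc k) = trans (*-identityˡ _) (1^k≡1 k)

  ^-distribʳ-* : ∀ x y k → (x * y) ^ k ≡ x ^ k * y ^ k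
  ^-distribʳ-* x y zero = sym (*-identityˡ 1#)
  ^-distribʳ-* x y (suc k) = trans (cong ((x * y) *_) (^-distribʳ-* x y k))
    (solve 4 (λ x y a b → (x :* y) :* (a :* b) := (x :* a) :* (y :* b)) refl x y (x ^ k) (y ^ k))

  ^-*-≡1 : ∀ {x} M → x ^ M ≡ 1# → ∀ t → x ^ (M ℕ.* t) ≡ 1#
  ^-*-≡1 {x} M xᴹ≡1 t = trans (sym (^-*-assoc x M t)) (trans (cong (_^ t) xᴹ≡1) (1^k≡1 t))

  ^-% : ∀ {x} M .{{_ : ℕ.NonZero M}} → x ^ M ≡ 1# → ∀ k → x ^ (k % M) ≡ x ^ k
  ^-% {x} M xᴹ≡1 k = sym (begin
    x ^ k                               ≡⟨ cong (x ^_) (m≡m%n+[m/n]*n k M) ⟩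
    x ^ (k % M ℕ.+ (k / M) ℕ.* M)       ≡⟨ ^-distribˡ-+-* x (k % M) _ ⟩
    x ^ (k % M) * x ^ ((k / M) ℕ.* M)   ≡⟨ cong (λ e → x ^ (k % M) * x ^ e) (ℕ.*-comm (k / M) M) ⟩
    x ^ (k % M) * x ^ (M ℕ.* (k / M))   ≡⟨ cong (x ^ (k % M) *_) (^-*-≡1 M xᴹ≡1 (k / M)) ⟩
    x ^ (k % M) * 1#                    ≡⟨ *-identityʳ _ ⟩
    x ^ (k % M)                         ∎)

  ^-mod : ∀ {x} M .{{_ : ℕ.NonZero M}} → x ^ M ≡ 1# → ∀ k → x ^ toℕ (k mod M) ≡ x ^ k
  ^-mod {x} M xᴹ≡1 k = trans (cong (x ^_) (Fin.toℕ-fromℕ< (m%n<n k M))) (^-% M xᴹ≡1 k)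

  ^-nextFin : ∀ {k h} → h ^ k ≡ 1# → (j : Fin k) → h ^ toℕ (nextFin j) ≡ h ^ suc (toℕ j)
  ^-nextFin {suc k} {h} hᵏ≡1 j with suc (toℕ j) ℕ.<? suc k
  ... | yes j+1<k = cong (h ^_) (Fin.toℕ-fromℕ< j+1<k)
  ... | no j+1≮k = trans (sym hᵏ≡1) (cong (λ t → h ^ suc t) (sym j≡k))
    where
    j≡k : toℕ j ≡ k
    j≡k = ℕ.≤-antisym (ℕ.≤-pred (Fin.toℕ<n j)) (ℕ.≮⇒≥ (λ j<k → j+1≮k (s≤s j<k)))

  ^-nonzero : ∀ {x L} → 0 ℕ.< L → x ^ L ≡ 1# → ∀ k → x ^ k ≢ 0#
  ^-nonzero {x} {suc L} _ xᴸ≡1 k xᵏ≡0 = 0≢1 (begin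
    0#                          ≡⟨ sym (zeroˡ _) ⟩
    0# * (0# ^ L)               ≡⟨ cong (_^ suc L) (sym xᵏ≡0) ⟩
    (x ^ k) ^ suc L             ≡⟨ ^-*-assoc x k (suc L) ⟩
    x ^ (k ℕ.* suc L)           ≡⟨ cong (x ^_) (ℕ.*-comm k (suc L)) ⟩
    x ^ (suc L ℕ.* k)           ≡⟨ ^-*-≡1 (suc L) xᴸ≡1 k ⟩
    1#                          ∎)

  order-pow-injective-≤ : ∀ {h L} → HasOrder h L → ∀ {i j} → i ℕ.≤ j → j ℕ.< L → h ^ i ≡ h ^ j → i ≡ j
  order-pow-injective-≤ {h} (L>0 , hᴸ≡1 , minimal) {i} {j} i≤j j<L hⁱ≡hʲ with j ℕ.∸ i ℕ.≟ 0
  ... | yes d≡0 = ℕ.≤-antisym i≤j (ℕ.m∸n≡0⇒m≤n d≡0)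
  ... | no d≢0 = ⊥-elim (minimal (j ℕ.∸ i) (ℕ.n≢0⇒n>0 d≢0) (ℕ.≤-<-trans (ℕ.m∸n≤m j i) j<L) hᵈ≡1)
    where
    hᵈ≡1 : h ^ (j ℕ.∸ i) ≡ 1#
    hᵈ≡1 = sym (*-cancelˡ 1# (^-nonzero L>0 hᴸ≡1 i) (begin
      h ^ i * 1#                ≡⟨ *-identityʳ _ ⟩
      h ^ i                     ≡⟨ hⁱ≡hʲ ⟩
      h ^ j                     ≡⟨ cong (h ^_) (sym (ℕ.m+[n∸m]≡n i≤j)) ⟩
      h ^ (i ℕ.+ (j ℕ.∸ i))     ≡⟨ ^-distribˡ-+-* h i (j ℕ.∸ i) ⟩
      h ^ i * h ^ (j ℕ.∸ i)     ∎))

  order-pow-injective : ∀ {h L} → HasOrder h L → ∀ {i j} → i ℕ.< L → j ℕ.< L → h ^ i ≡ h ^ j → i ≡ j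
  order-pow-injective ord {i} {j} i<L j<L hⁱ≡hʲ with ℕ.≤-total i j
  ... | inj₁ i≤j = order-pow-injective-≤ ord i≤j j<L hⁱ≡hʲ
  ... | inj₂ j≤i = sym (order-pow-injective-≤ ord j≤i i<L (sym hⁱ≡hʲ))

  odd-order-of-cube-root : ∀ {h M} → HasOrder h M → Odd M → M ≢ 1 → h ^ 3 ≡ 1# → M ≡ 3
  odd-order-of-cube-root _ (zero , M≡1) M≢1 _ = ⊥-elim (M≢1 M≡1)
  odd-order-of-cube-root _ (suc zero , M≡3) _ _ = M≡3
  odd-order-of-cube-root (_ , _ , minimal) (suc (suc t) , refl) _ h³≡1 =
    ⊥-elim (minimal 3 (s≤s z≤n) (s≤s (s≤s (s≤s (ℕ.≤-trans (s≤s z≤n) (ℕ.m≤n+m _ t))))) h³≡1)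

  cube-root-of-unity : ∀ {h z} → (1# + h) * z ≡ - 1# → h * (z + 1#) ≡ - 1# → h ^ 3 ≡ 1#
  cube-root-of-unity {h} {z} [1+h]z≡-1 h[z+1]≡-1 = begin
    h ^ 3                                   ≡⟨ solve 1 (λ h → h :* (h :* (h :* con 1ℤ)) := h :* ((con 1ℤ :+ h) :* h) :- (con 1ℤ :+ h) :* h :+ h) refl h ⟩
    h * ((1# + h) * h) - (1# + h) * h + h   ≡⟨ cong (λ w → h * w - w + h) [1+h]h≡-1 ⟩
    h * - 1# - - 1# + h                     ≡⟨ solve 1 (λ h → h :* (:- con 1ℤ) :- (:- con 1ℤ) :+ h := con 1ℤ) refl h ⟩
    1#                                      ∎
    where
    z≡h : z ≡ h
    z≡h = begin
      z                                     ≡⟨ solve 2 (λ h z → z := (con 1ℤ :+ h) :* z :- h :* (z :+ con 1ℤ) :+ h) refl h z ⟩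
      (1# + h) * z - h * (z + 1#) + h       ≡⟨ cong₂ (λ u v → u - v + h) [1+h]z≡-1 h[z+1]≡-1 ⟩
      - 1# - - 1# + h                       ≡⟨ solve 1 (λ h → :- con 1ℤ :- (:- con 1ℤ) :+ h := h) refl h ⟩
      h                                     ∎
    [1+h]h≡-1 : (1# + h) * h ≡ - 1#
    [1+h]h≡-1 = trans (cong ((1# + h) *_) (sym z≡h)) [1+h]z≡-1

  geometric : F → ℕ → F
  geometric h zero = 0#
  geometric h (suc k) = 1# + h * geometric h k

  geometric-suc : ∀ h k → geometric h (suc k) ≡ geometric h k + h ^ k
  geometric-suc h zero = solve 1 (λ h → con 1ℤ :+ h :* con 0ℤ := con 0ℤ :+ con 1ℤ) refl h
  geometric-suc h (suc k) = begin
    1# + h * geometric h (suc k)          ≡⟨ cong (λ s → 1# + h * s) (geometric-suc h k) ⟩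
    1# + h * (geometric h k + h ^ k)      ≡⟨ solve 3 (λ h s p → con 1ℤ :+ h :* (s :+ p) := (con 1ℤ :+ h :* s) :+ h :* p) refl
                                                    h (geometric h k) (h ^ k) ⟩
    geometric h (suc k) + h ^ suc k       ∎

  geometric-telescope : ∀ h k → (1# - h) * geometric h k ≡ 1# - h ^ k
  geometric-telescope h zero = solve 1 (λ h → (con 1ℤ :- h) :* con 0ℤ := con 1ℤ :- con 1ℤ) refl h
  geometric-telescope h (suc k) = begin
    (1# - h) * (1# + h * geometric h k)         ≡⟨ solve 2 (λ h s → (con 1ℤ :- h) :* (con 1ℤ :+ h :* s)
                                                         := (con 1ℤ :- h) :+ h :* ((con 1ℤ :- h) :* s)) refl h (geometric h k) ⟩
    (1# - h) + h * ((1# - h) * geometric h k)   ≡⟨ cong (λ s → (1# - h) + h * s) (geometric-telescope h k) ⟩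
    (1# - h) + h * (1# - h ^ k)                 ≡⟨ solve 2 (λ h p → (con 1ℤ :- h) :+ h :* (con 1ℤ :- p) := con 1ℤ :- h :* p) refl h (h ^ k) ⟩
    1# - h ^ suc k                              ∎

  geometric-injective : ∀ {h L} → HasOrder h L → ∀ {i j} → i ℕ.< L → j ℕ.< L →
                        geometric h i ≡ geometric h j → i ≡ j
  geometric-injective {h} ord {i} {j} i<L j<L sᵢ≡sⱼ = order-pow-injective ord i<L j<L (begin
    h ^ i                  ≡⟨ solve 1 (λ p → p := con 1ℤ :- (con 1ℤ :- p)) refl (h ^ i) ⟩
    1# - (1# - h ^ i)      ≡⟨ cong (λ s → 1# - s) (sym (geometric-telescope h i)) ⟩
    1# - (1# - h) * geometric h i ≡⟨ cong (λ s → 1# - (1# - h) * s) sᵢ≡sⱼ ⟩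
    1# - (1# - h) * geometric h j ≡⟨ cong (λ s → 1# - s) (geometric-telescope h j) ⟩
    1# - (1# - h ^ j)      ≡⟨ solve 1 (λ p → con 1ℤ :- (con 1ℤ :- p) := p) refl (h ^ j) ⟩
    h ^ j                  ∎)

  sumFin-cong : ∀ k {f g : Fin k → F} → (∀ i → f i ≡ g i) → sumFin k f ≡ sumFin k g
  sumFin-cong zero f≗g = refl
  sumFin-cong (suc k) f≗g = cong₂ _+_ (f≗g Fin.zero) (sumFin-cong k (λ i → f≗g (Fin.suc i)))

  sumFin-*ˡ : ∀ k c (f : Fin k → F) → c * sumFin k f ≡ sumFin k (λ i → c * f i)
  sumFin-*ˡ zero c f = zeroʳ c
  sumFin-*ˡ (suc k) c f = trans (distribˡ c _ _) (cong ((c * f Fin.zero) +_) (sumFin-*ˡ k c (λ i → f (Fin.suc i))))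

  sumFin-powers : ∀ h k → sumFin k (λ i → h ^ toℕ i) ≡ geometric h k
  sumFin-powers h zero = refl
  sumFin-powers h (suc k) =
    cong (1# +_) (trans (sym (sumFin-*ˡ k h (λ i → h ^ toℕ i))) (cong (h *_) (sumFin-powers h k)))

  affine-bijective : ∀ {c} t → c ≢ 0# → Bijective _≡_ _≡_ (λ x → c * x + t)
  affine-bijective {c} t c≢0 = (λ eq → *-cancelˡ _ c≢0 (+-cancelʳ t eq)) , λ y → c⁻¹ * (y - t) , λ { refl → begin
    c * (c⁻¹ * (y - t)) + t     ≡⟨ cong (_+ t) (sym (*-assoc c c⁻¹ _)) ⟩
    (c * c⁻¹) * (y - t) + t     ≡⟨ cong (λ u → u * (y - t) + t) (proj₂ (inv c c≢0)) ⟩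
    1# * (y - t) + t            ≡⟨ solve 2 (λ y t → con 1ℤ :* (y :- t) :+ t := y) refl y t ⟩
    y                           ∎ }
    where c⁻¹ = proj₁ (inv c c≢0)

  affine-on-nonzero : ∀ (σ : F → F) c → (∀ x → x ≢ 0# → σ x ≡ c * x + σ 0#) → ∀ x → σ x ≡ c * x + σ 0#
  affine-on-nonzero σ c σ≐ x with x ≟ 0#
  ... | yes refl = sym (trans (cong (_+ σ 0#) (zeroʳ c)) (+-identityˡ _))
  ... | no x≢0 = σ≐ x x≢0

  singleton-sum-nonzero : ∀ {k} (f : Fin k → F) → k ≡ 1 → (∀ i → f i ≢ 0#) → sumFin k f ≢ 0#
  singleton-sum-nonzero f refl f≢0 sum≡0 = f≢0 Fin.zero (trans (sym (+-identityʳ _)) sum≡0)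

  separating-exponent : ∀ {α β M N} → Coprime M N → 0 ℕ.< N → α ^ M ≡ 1# → β ^ N ≡ 1# →
                        ∃ λ P → α ^ P ≡ 1# × β ^ P ≡ β
  separating-exponent {α} {β} {M} {N} coprime N>0 αᴹ≡1 βᴺ≡1 with coprime-Bézout coprime
  ... | Bézout.+- x y 1+yN≡xM = M ℕ.* x , ^-*-≡1 M αᴹ≡1 x , (begin
    β ^ (M ℕ.* x)             ≡⟨ cong (β ^_) (trans (ℕ.*-comm M x) (sym 1+yN≡xM)) ⟩
    β * β ^ (y ℕ.* N)         ≡⟨ cong (λ e → β * β ^ e) (ℕ.*-comm y N) ⟩
    β * β ^ (N ℕ.* y)         ≡⟨ cong (β *_) (^-*-≡1 N βᴺ≡1 y) ⟩
    β * 1#                    ≡⟨ *-identityʳ β ⟩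
    β                         ∎)
  ... | Bézout.-+ x y 1+xM≡yN =
    -- β ^ (M * x) is the inverse of β, so its (N - 1)-st power is β.
    M ℕ.* x ℕ.* (N ℕ.∸ 1) , ^-*-≡1 (M ℕ.* x) (^-*-≡1 M αᴹ≡1 x) (N ℕ.∸ 1) ,
    trans (sym (^-*-assoc β (M ℕ.* x) (N ℕ.∸ 1))) (*-inverse-unique wβ-product ββ-product)
    where
    w : F
    w = β ^ (M ℕ.* x)
    βw≡1 : β * w ≡ 1#
    βw≡1 = begin
      β ^ suc (M ℕ.* x)   ≡⟨ cong (λ e → β ^ suc e) (ℕ.*-comm M x) ⟩
      β ^ suc (x ℕ.* M)   ≡⟨ cong (β ^_) 1+xM≡yN ⟩
      β ^ (y ℕ.* N)       ≡⟨ cong (β ^_) (ℕ.*-comm y N) ⟩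
      β ^ (N ℕ.* y)       ≡⟨ ^-*-≡1 N βᴺ≡1 y ⟩
      1#                  ∎
    wβ-product : w ^ (N ℕ.∸ 1) * β ^ (N ℕ.∸ 1) ≡ 1#
    wβ-product = trans (sym (^-distribʳ-* w β (N ℕ.∸ 1)))
                       (trans (cong (_^ (N ℕ.∸ 1)) (trans (*-comm w β) βw≡1)) (1^k≡1 (N ℕ.∸ 1)))
    ββ-product : β ^ (N ℕ.∸ 1) * β ≡ 1#
    ββ-product = trans (*-comm _ β) (trans (cong (β ^_) (ℕ.m+[n∸m]≡n {1} N>0)) βᴺ≡1)

module RotationSystem (K : FiniteField) {m n : ℕ} (a : Fin m → Fin n → FiniteField.F K) where
  open FieldProperties K
  open Embedding K
  open ≡-Reasoning

  ρ₀ : F → F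
  ρ₀ = rho0 m n a

  Rot : F → F → F
  Rot = rot m n a

  step : F × F → F × F
  step = faceStep m n a

  Face : F × F → ℕ → Set
  Face = FaceIsSimpleCycleOfLength m n a

  Commutes : (F → F) → Set
  Commutes τ = ∀ x y → x ≢ y → τ (Rot x y) ≡ Rot (τ x) (τ y)

  Reverses : (F → F) → Set
  Reverses τ = ∀ x y → x ≢ y → Rot (τ x) (τ (Rot x y)) ≡ τ y

  iter-+ : ∀ {A : Set} (f : A → A) i j x → iter f (i ℕ.+ j) x ≡ iter f i (iter f j x)
  iter-+ f zero j x = refl
  iter-+ f (suc i) j x = cong f (iter-+ f i j x)

  iter-suc : ∀ {A : Set} (f : A → A) k x → iter f (suc k) x ≡ iter f k (f x)
  iter-suc f k x = trans (cong (λ i → iter f i x) (ℕ.+-comm 1 k)) (iter-+ f k 1 x)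

  iter-periodic : ∀ {A : Set} (f : A → A) L x → iter f L x ≡ x → ∀ t → iter f (t ℕ.* L) x ≡ x
  iter-periodic f L x fᴸx≡x zero = refl
  iter-periodic f L x fᴸx≡x (suc t) =
    trans (iter-+ f L (t ℕ.* L) x) (trans (cong (iter f L) (iter-periodic f L x fᴸx≡x t)) fᴸx≡x)

  rot-origin : ∀ y → Rot 0# y ≡ ρ₀ y
  rot-origin y = trans (+-identityˡ _) (cong ρ₀ (solve 1 (λ y → y :- con 0ℤ := y) refl y))

  rot-affine : ∀ {c} → (∀ x → ρ₀ (c * x) ≡ c * ρ₀ x) → ∀ t x y → Rot (c * x + t) (c * y + t) ≡ c * Rot x y + t
  rot-affine {c} ρ₀-scale t x y = begin
    (c * x + t) + ρ₀ ((c * y + t) - (c * x + t))  ≡⟨ cong (λ z → (c * x + t) + ρ₀ z)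
                                                        (solve 4 (λ c x y t → (c :* y :+ t) :- (c :* x :+ t) := c :* (y :- x)) refl c x y t) ⟩
    (c * x + t) + ρ₀ (c * (y - x))                ≡⟨ cong ((c * x + t) +_) (ρ₀-scale (y - x)) ⟩
    (c * x + t) + c * ρ₀ (y - x)                  ≡⟨ solve 4 (λ c x t r → (c :* x :+ t) :+ c :* r := c :* (x :+ r) :+ t) refl c x t _ ⟩
    c * (x + ρ₀ (y - x)) + t                      ∎

  rot≡0 : ∀ {u v} → Rot u v ≡ 0# → ρ₀ (v - u) ≡ - u
  rot≡0 {u} {v} u+ρ₀[v-u]≡0 = begin
    ρ₀ (v - u)               ≡⟨ solve 2 (λ u r → r := (u :+ r) :- u) refl u _ ⟩
    (u + ρ₀ (v - u)) - u     ≡⟨ cong (_- u) u+ρ₀[v-u]≡0 ⟩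
    0# - u                   ≡⟨ +-identityˡ _ ⟩
    - u                      ∎

  module _ (ρ₀-reflects-0 : ∀ z → ρ₀ z ≡ 0# → z ≡ 0#) where

    rot-≢ : ∀ {x y} → x ≢ y → Rot y x ≢ y
    rot-≢ {x} {y} x≢y y+ρ₀[x-y]≡y = x≢y (begin
      x               ≡⟨ solve 2 (λ x y → x := (x :- y) :+ y) refl x y ⟩
      (x - y) + y     ≡⟨ cong (_+ y) (ρ₀-reflects-0 _ ρ₀[x-y]≡0) ⟩
      0# + y          ≡⟨ +-identityˡ y ⟩
      y               ∎)
      where
      ρ₀[x-y]≡0 : ρ₀ (x - y) ≡ 0#
      ρ₀[x-y]≡0 = begin
        ρ₀ (x - y)             ≡⟨ solve 2 (λ y r → r := (y :+ r) :- y) refl y _ ⟩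
        (y + ρ₀ (x - y)) - y   ≡⟨ cong (_- y) y+ρ₀[x-y]≡y ⟩
        y - y                  ≡⟨ -‿inverseʳ y ⟩
        0#                     ∎

    iter-step-≢ : ∀ k {x y} → x ≢ y → proj₁ (iter step k (x , y)) ≢ proj₂ (iter step k (x , y))
    iter-step-≢ zero x≢y = x≢y
    iter-step-≢ (suc k) x≢y eq = rot-≢ (iter-step-≢ k x≢y) (sym eq)

    iter-commutes : ∀ {τ} → Commutes τ → ∀ k {x y} → x ≢ y →
                    iter step k (τ x , τ y) ≡ map τ τ (iter step k (x , y))
    iter-commutes τ-commutes zero x≢y = refl
    iter-commutes {τ} τ-commutes (suc k) {x} {y} x≢y =
      trans (cong step (iter-commutes τ-commutes k x≢y))
            (cong (τ (proj₂ p) ,_) (sym (τ-commutes (proj₂ p) (proj₁ p) (λ eq → iter-step-≢ k x≢y (sym eq)))))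
      where p = iter step k (x , y)

    iter-reverses : ∀ {τ} → Reverses τ → ∀ k {x y} → x ≢ y →
                    iter step k (swap (map τ τ (iter step k (x , y)))) ≡ (τ y , τ x)
    iter-reverses τ-reverses zero x≢y = refl
    iter-reverses {τ} τ-reverses (suc k) {x} {y} x≢y = begin
      iter step (suc k) (τ (Rot q p) , τ q)    ≡⟨ iter-suc step k _ ⟩
      iter step k (τ q , Rot (τ q) (τ (Rot q p)))
          ≡⟨ cong (λ z → iter step k (τ q , z)) (τ-reverses q p (λ eq → iter-step-≢ k x≢y (sym eq))) ⟩
      iter step k (τ q , τ p)                  ≡⟨ iter-reverses τ-reverses k x≢y ⟩
      (τ y , τ x)                              ∎
      where
      p = proj₁ (iter step k (x , y))
      q = proj₂ (iter step k (x , y))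

  geometric-face-vertices : ∀ x {D h} → (∀ k → ρ₀ (- (D * h ^ k)) ≡ D * h ^ suc k) →
                            ∀ k → iter step k (x , x + D) ≡ (x + D * geometric h k , x + D * geometric h (suc k))
  geometric-face-vertices x {D} {h} turn zero =
    cong₂ _,_ (solve 2 (λ x D → x := x :+ D :* con 0ℤ) refl x D)
              (solve 3 (λ x D h → x :+ D := x :+ D :* (con 1ℤ :+ h :* con 0ℤ)) refl x D h)
  geometric-face-vertices x {D} {h} turn (suc k) =
    trans (cong step (geometric-face-vertices x turn k)) (cong (v₁ ,_) next)
    where
    v₀ = x + D * geometric h k
    v₁ = x + D * geometric h (suc k)
    back-edge : v₀ - v₁ ≡ - (D * h ^ k)
    back-edge = trans (cong (λ s → v₀ - (x + D * s)) (geometric-suc h k))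
      (solve 4 (λ x D s p → (x :+ D :* s) :- (x :+ D :* (s :+ p)) := :- (D :* p)) refl x D (geometric h k) (h ^ k))
    next : v₁ + ρ₀ (v₀ - v₁) ≡ x + D * geometric h (suc (suc k))
    next = begin
      v₁ + ρ₀ (v₀ - v₁)                           ≡⟨ cong (λ z → v₁ + ρ₀ z) back-edge ⟩
      v₁ + ρ₀ (- (D * h ^ k))                     ≡⟨ cong (v₁ +_) (turn k) ⟩
      v₁ + D * h ^ suc k                          ≡⟨ solve 4 (λ x D s p → (x :+ D :* s) :+ D :* p := x :+ D :* (s :+ p))
                                                            refl x D (geometric h (suc k)) (h ^ suc k) ⟩
      x + D * (geometric h (suc k) + h ^ suc k)   ≡⟨ cong (λ s → x + D * s) (sym (geometric-suc h (suc k))) ⟩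
      x + D * geometric h (suc (suc k))           ∎

  geometric-face : ∀ x {D h L} → D ≢ 0# → HasOrder h L → geometric h L ≡ 0# →
                   (∀ k → ρ₀ (- (D * h ^ k)) ≡ D * h ^ suc k) → Face (x , x + D) L
  geometric-face x {D} {h} {L} D≢0 ord@(_ , hᴸ≡1 , _) sᴸ≡0 turn = closes , distinct
    where
    vertices : ∀ k → iter step k (x , x + D) ≡ (x + D * geometric h k , x + D * geometric h (suc k))
    vertices = geometric-face-vertices x turn
    closes : iter step L (x , x + D) ≡ (x , x + D)
    closes = trans (vertices L) (cong₂ _,_
      (trans (cong (λ s → x + D * s) sᴸ≡0) (solve 2 (λ x D → x :+ D :* con 0ℤ := x) refl x D))
      (trans (cong (λ s → x + D * s) (trans (geometric-suc h L) (cong₂ _+_ sᴸ≡0 hᴸ≡1)))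
             (solve 2 (λ x D → x :+ D :* (con 0ℤ :+ con 1ℤ) := x :+ D) refl x D)))
    distinct : ∀ i j → i ℕ.< j → j ℕ.< L → proj₁ (iter step i (x , x + D)) ≢ proj₁ (iter step j (x , x + D))
    distinct i j i<j j<L vᵢ≡vⱼ = ℕ.<-irrefl i≡j i<j
      where
      i≡j : i ≡ j
      i≡j = geometric-injective ord (ℕ.<-trans i<j j<L) j<L
              (*-cancelˡ _ D≢0 (+-cancelˡ x (trans (sym (cong proj₁ (vertices i))) (trans vᵢ≡vⱼ (cong proj₁ (vertices j))))))

  face-period-divides : ∀ {d L M} → Face d L → 0 ℕ.< L → iter step M d ≡ d → L ∣ M
  face-period-divides {d} {suc L′} {M} (closes , distinct) ℕ.z<s returns with M % suc L′ ℕ.≟ 0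
  ... | yes r≡0 = m%n≡0⇒n∣m M (suc L′) r≡0
  ... | no r≢0 = ⊥-elim (distinct 0 (M % L) (ℕ.n≢0⇒n>0 r≢0) (m%n<n M L) (sym (cong proj₁ returns-after-r)))
    where
    L = suc L′
    returns-after-r : iter step (M % L) d ≡ d
    returns-after-r = begin
      iter step (M % L) d                           ≡⟨ cong (iter step (M % L)) (sym (iter-periodic step L d closes (M / L))) ⟩
      iter step (M % L) (iter step (M / L ℕ.* L) d) ≡⟨ sym (iter-+ step (M % L) _ d) ⟩
      iter step (M % L ℕ.+ M / L ℕ.* L) d           ≡⟨ cong (λ k → iter step k d) (sym (m≡m%n+[m/n]*n M L)) ⟩
      iter step M d                                 ≡⟨ returns ⟩
      d                                             ∎

  IsAut-resp-≐ : ∀ {σ τ} → σ ≐ τ → IsAut m n a σ → IsAut m n a τ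
  IsAut-resp-≐ {σ} {τ} σ≐τ ((injective , surjective) , orientation) =
    (injective′ , surjective′) , Data.Sum.map commutes′ reverses′ orientation
    where
    injective′ : ∀ {x y} → τ x ≡ τ y → x ≡ y
    injective′ {x} {y} eq = injective (trans (σ≐τ x) (trans eq (sym (σ≐τ y))))
    surjective′ : ∀ y → ∃ λ x → ∀ {z} → z ≡ x → τ z ≡ y
    surjective′ y = proj₁ (surjective y) , λ {z} z≡x → trans (sym (σ≐τ z)) (proj₂ (surjective y) z≡x)
    commutes′ : Commutes σ → Commutes τ
    commutes′ c x y x≢y = trans (sym (σ≐τ _)) (trans (c x y x≢y) (cong₂ Rot (σ≐τ x) (σ≐τ y)))
    reverses′ : Reverses σ → Reverses τ
    reverses′ r x y x≢y = trans (cong₂ Rot (sym (σ≐τ x)) (sym (σ≐τ _))) (trans (r x y x≢y) (σ≐τ y))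

  orbit-induction : (∀ x → x ≢ 0# → ρ₀ x ≢ 0#) → (∀ x → x ≢ 0# → ∃ λ k → iter ρ₀ k 1# ≡ x) →
                    (P : F → Set) → P 1# → (∀ x → x ≢ 0# → P x → P (ρ₀ x)) → ∀ x → x ≢ 0# → P x
  orbit-induction ρ₀-nonzero orbit P P1 P-step x x≢0 =
    subst P (proj₂ (orbit x x≢0)) (proj₂ (along (proj₁ (orbit x x≢0))))
    where
    along : ∀ k → iter ρ₀ k 1# ≢ 0# × P (iter ρ₀ k 1#)
    along zero = 1≢0 , P1
    along (suc k) = ρ₀-nonzero _ (proj₁ (along k)) , P-step _ (proj₁ (along k)) (proj₂ (along k))

  module _ {c t} (c≢0 : c ≢ 0#) (ρ₀-scale : ∀ x → ρ₀ (c * x) ≡ c * ρ₀ x) {σ τ : F → F}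
           (σ≐cτ+t : ∀ x → σ x ≡ c * τ x + t) where

    private
      Rot-σ : ∀ x y → Rot (σ x) (σ y) ≡ c * Rot (τ x) (τ y) + t
      Rot-σ x y = trans (cong₂ Rot (σ≐cτ+t x) (σ≐cτ+t y)) (rot-affine ρ₀-scale t (τ x) (τ y))

      unscale : ∀ {u v} → c * u + t ≡ c * v + t → u ≡ v
      unscale eq = *-cancelˡ _ c≢0 (+-cancelʳ t eq)

    commutes-unscale : Commutes σ → Commutes τ
    commutes-unscale σ-commutes x y x≢y =
      unscale (trans (sym (σ≐cτ+t _)) (trans (σ-commutes x y x≢y) (Rot-σ x y)))

    reverses-unscale : Reverses σ → Reverses τ
    reverses-unscale σ-reverses x y x≢y =
      unscale (trans (sym (Rot-σ x (Rot x y))) (trans (σ-reverses x y x≢y) (σ≐cτ+t y)))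

module _ (K : FiniteField) where
  open FiniteField K using (F; size; enum)
  open Embedding K using (HasCard; _≐_)

  HasCard-via-↔ : ∀ {T : Set} {N} {P : (F → F) → Set} → T ↔ Fin N → (φ : T → F → F) → (∀ t → P (φ t)) →
                  (∀ s t → φ s ≐ φ t → s ≡ t) → (∀ σ → P σ → ∃ λ t → φ t ≐ σ) → HasCard P N
  HasCard-via-↔ T↔N φ φ∈ φ-injective φ-surjective = record
    { e = λ i → φ (from i)
    ; e∈ = λ i → φ∈ (from i)
    ; inj = λ i j φi≐φj → trans (sym (inverseˡ refl)) (trans (cong to (φ-injective _ _ φi≐φj)) (inverseˡ refl))
    ; surj = λ σ Pσ → to (proj₁ (φ-surjective σ Pσ)) ,
                      λ x → trans (cong (λ t → φ t x) (inverseʳ refl)) (proj₂ (φ-surjective σ Pσ) x)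
    }
    where open Inverse T↔N

module ArchdeaconEmbedding
  (K : FiniteField) (m n : ℕ) (m>0 : 0 ℕ.< m) (n>0 : 0 ℕ.< n) (odd-m : Odd m) (odd-n : Odd n)
  (coprime : Coprime m n) (ξ ε : FiniteField.F K)
  (ord-ξ : FiniteField.HasOrder K ξ n) (ord-ε : FiniteField.HasOrder K ε m)
  (heffter : Embedding.IsHeffter K m n (Embedding.arrayA K ε ξ))
  where

  open FieldProperties K
  open Embedding K
  open ≡-Reasoning

  A : Fin m → Fin n → F
  A = arrayA ε ξ

  open RotationSystem K A

  instance
    m-nonZero : ℕ.NonZero m
    m-nonZero = ℕ.>-nonZero m>0
    n-nonZero : ℕ.NonZero n
    n-nonZero = ℕ.>-nonZero n>0

  εᵐ≡1 : ε ^ m ≡ 1#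
  εᵐ≡1 = proj₁ (proj₂ ord-ε)

  ξⁿ≡1 : ξ ^ n ≡ 1#
  ξⁿ≡1 = proj₁ (proj₂ ord-ξ)

  rows-sum-to-0 : ∀ i → sumFin n (A i) ≡ 0#
  rows-sum-to-0 = proj₁ heffter

  columns-sum-to-0 : ∀ j → sumFin m (λ i → A i j) ≡ 0#
  columns-sum-to-0 = proj₁ (proj₂ heffter)

  entries-nonzero : ∀ i j → A i j ≢ 0#
  entries-nonzero = proj₁ (proj₂ (proj₂ heffter))

  entries-unique : ∀ i j s i′ j′ s′ → signed s (A i j) ≡ signed s′ (A i′ j′) → i ≡ i′ × j ≡ j′ × s ≡ s′
  entries-unique = proj₂ (proj₂ (proj₂ (proj₂ heffter)))

  e : ℕ → ℕ → F
  e i j = ε ^ i * ξ ^ j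

  e-entry : ∀ i j → e i j ≡ A (i mod m) (j mod n)
  e-entry i j = sym (cong₂ _*_ (^-mod m εᵐ≡1 i) (^-mod n ξⁿ≡1 j))

  e-cover : ∀ x → x ≢ 0# → ∃ λ s → ∃ λ i → ∃ λ j → signed s (e i j) ≡ x
  e-cover x x≢0 with proj₁ (proj₂ (proj₂ (proj₂ heffter))) x x≢0
  ... | i , j , s , sAᵢⱼ≡x = s , toℕ i , toℕ j , sAᵢⱼ≡x

  e-nonzero : ∀ i j → e i j ≢ 0#
  e-nonzero i j eᵢⱼ≡0 = entries-nonzero (i mod m) (j mod n) (trans (sym (e-entry i j)) eᵢⱼ≡0)

  e-injective : ∀ {i j i′ j′} → e i j ≡ e i′ j′ → i mod m ≡ i′ mod m × j mod n ≡ j′ mod n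
  e-injective {i} {j} {i′} {j′} eq
    with entries-unique (i mod m) (j mod n) true (i′ mod m) (j′ mod n) true
                        (trans (sym (e-entry i j)) (trans eq (e-entry i′ j′)))
  ... | i≡i′ , j≡j′ , _ = i≡i′ , j≡j′

  e≢-e : ∀ i j i′ j′ → e i j ≢ - e i′ j′
  e≢-e i j i′ j′ eq
    with entries-unique (i mod m) (j mod n) true (i′ mod m) (j′ mod n) false
                        (trans (sym (e-entry i j)) (trans eq (cong -_ (e-entry i′ j′))))
  ... | _ , _ , ()

  ρ₀-entry : ∀ i j → ρ₀ (A i j) ≡ - A i (nextFin j)
  ρ₀-entry i j with Fin.any? (λ i′ → Fin.any? (λ j′ → A i′ j′ ≟ A i j))
  ... | yes (i′ , j′ , Aᵢ′ⱼ′≡Aᵢⱼ) with entries-unique i′ j′ true i j true Aᵢ′ⱼ′≡Aᵢⱼ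
  ...   | refl , refl , _ = refl
  ρ₀-entry i j | no ∄ = ⊥-elim (∄ (i , j , refl))

  ρ₀-neg-entry : ∀ i j → ρ₀ (- A i j) ≡ A (nextFin i) j
  ρ₀-neg-entry i j with Fin.any? (λ i′ → Fin.any? (λ j′ → A i′ j′ ≟ (- A i j)))
  ... | yes (i′ , j′ , Aᵢ′ⱼ′≡-Aᵢⱼ) with entries-unique i′ j′ true i j false Aᵢ′ⱼ′≡-Aᵢⱼ
  ...   | _ , _ , ()
  ρ₀-neg-entry i j | no _ with Fin.any? (λ i′ → Fin.any? (λ j′ → A i′ j′ ≟ (- (- A i j))))
  ...   | yes (i′ , j′ , Aᵢ′ⱼ′≡Aᵢⱼ) with entries-unique i′ j′ true i j true (trans Aᵢ′ⱼ′≡Aᵢⱼ (-‿involutive _))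
  ...     | refl , refl , _ = refl
  ρ₀-neg-entry i j | no _ | no ∄ = ⊥-elim (∄ (i , j , sym (-‿involutive _)))

  ρ₀-0 : ρ₀ 0# ≡ 0#
  ρ₀-0 with Fin.any? (λ i′ → Fin.any? (λ j′ → A i′ j′ ≟ 0#))
  ... | yes (i′ , j′ , Aᵢ′ⱼ′≡0) = ⊥-elim (entries-nonzero i′ j′ Aᵢ′ⱼ′≡0)
  ... | no _ with Fin.any? (λ i′ → Fin.any? (λ j′ → A i′ j′ ≟ (- 0#)))
  ...   | yes (i′ , j′ , Aᵢ′ⱼ′≡-0) = ⊥-elim (entries-nonzero i′ j′ (trans Aᵢ′ⱼ′≡-0 -0#≈0#))
  ...   | no _ = refl

  ρ₀-e : ∀ i j → ρ₀ (e i j) ≡ - e i (suc j)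
  ρ₀-e i j = begin
    ρ₀ (e i j)                                            ≡⟨ cong ρ₀ (e-entry i j) ⟩
    ρ₀ (A (i mod m) (j mod n))                            ≡⟨ ρ₀-entry (i mod m) (j mod n) ⟩
    - (ε ^ toℕ (i mod m) * ξ ^ toℕ (nextFin (j mod n)))   ≡⟨ cong₂ (λ u v → - (u * v)) (^-mod m εᵐ≡1 i)
                                                               (trans (^-nextFin ξⁿ≡1 (j mod n)) (cong (ξ *_) (^-mod n ξⁿ≡1 j))) ⟩
    - e i (suc j)                                         ∎

  ρ₀-neg-e : ∀ i j → ρ₀ (- e i j) ≡ e (suc i) j
  ρ₀-neg-e i j = begin
    ρ₀ (- e i j)                                          ≡⟨ cong (λ x → ρ₀ (- x)) (e-entry i j) ⟩
    ρ₀ (- A (i mod m) (j mod n))                          ≡⟨ ρ₀-neg-entry (i mod m) (j mod n) ⟩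
    ε ^ toℕ (nextFin (i mod m)) * ξ ^ toℕ (j mod n)       ≡⟨ cong₂ _*_ (trans (^-nextFin εᵐ≡1 (i mod m)) (cong (ε *_) (^-mod m εᵐ≡1 i)))
                                                               (^-mod n ξⁿ≡1 j) ⟩
    e (suc i) j                                           ∎

  e-0-0 : e 0 0 ≡ 1#
  e-0-0 = *-identityˡ 1#

  e-1-0 : e 1 0 ≡ ε
  e-1-0 = solve 1 (λ x → (x :* con 1ℤ) :* con 1ℤ := x) refl ε

  e-0-1 : e 0 1 ≡ ξ
  e-0-1 = solve 1 (λ x → con 1ℤ :* (x :* con 1ℤ) := x) refl ξ

  e-* : ∀ i j i′ j′ → e i j * e i′ j′ ≡ e (i ℕ.+ i′) (j ℕ.+ j′)
  e-* i j i′ j′ = trans (solve 4 (λ a b c d → (a :* b) :* (c :* d) := (a :* c) :* (b :* d)) refl (ε ^ i) (ξ ^ j) (ε ^ i′) (ξ ^ j′))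
                        (sym (cong₂ _*_ (^-distribˡ-+-* ε i i′) (^-distribˡ-+-* ξ j j′)))

  e-*-ε^ : ∀ k i j → e i j * ε ^ k ≡ e (k ℕ.+ i) j
  e-*-ε^ k i j = trans (solve 3 (λ a b c → (a :* b) :* c := (c :* a) :* b) refl (ε ^ i) (ξ ^ j) (ε ^ k))
                       (cong (_* ξ ^ j) (sym (^-distribˡ-+-* ε k i)))

  e-*-ξ^ : ∀ k i j → e i j * ξ ^ k ≡ e i (k ℕ.+ j)
  e-*-ξ^ k i j = trans (*-assoc (ε ^ i) (ξ ^ j) (ξ ^ k))
                       (cong (ε ^ i *_) (trans (*-comm (ξ ^ j) (ξ ^ k)) (sym (^-distribˡ-+-* ξ k j))))

  ξ*e : ∀ i j → ξ * e i j ≡ e i (suc j)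
  ξ*e i j = solve 3 (λ x a b → x :* (a :* b) := a :* (x :* b)) refl ξ (ε ^ i) (ξ ^ j)

  ρ₀-scale : ∀ a b x → ρ₀ (e a b * x) ≡ e a b * ρ₀ x
  ρ₀-scale a b x with x ≟ 0#
  ... | yes refl = trans (cong ρ₀ (zeroʳ _)) (trans ρ₀-0 (sym (trans (cong (e a b *_) ρ₀-0) (zeroʳ _))))
  ... | no x≢0 with e-cover x x≢0
  ...   | true , i , j , refl = begin
          ρ₀ (e a b * e i j)                ≡⟨ cong ρ₀ (e-* a b i j) ⟩
          ρ₀ (e (a ℕ.+ i) (b ℕ.+ j))        ≡⟨ ρ₀-e (a ℕ.+ i) (b ℕ.+ j) ⟩
          - e (a ℕ.+ i) (suc (b ℕ.+ j))     ≡⟨ cong (λ k → - e (a ℕ.+ i) k) (sym (ℕ.+-suc b j)) ⟩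
          - e (a ℕ.+ i) (b ℕ.+ suc j)       ≡⟨ cong -_ (sym (e-* a b i (suc j))) ⟩
          - (e a b * e i (suc j))           ≡⟨ -‿distribʳ-* _ _ ⟩
          e a b * - e i (suc j)             ≡⟨ cong (e a b *_) (sym (ρ₀-e i j)) ⟩
          e a b * ρ₀ (e i j)                ∎
  ...   | false , i , j , refl = begin
          ρ₀ (e a b * - e i j)              ≡⟨ cong ρ₀ (trans (sym (-‿distribʳ-* _ _)) (cong -_ (e-* a b i j))) ⟩
          ρ₀ (- e (a ℕ.+ i) (b ℕ.+ j))      ≡⟨ ρ₀-neg-e (a ℕ.+ i) (b ℕ.+ j) ⟩
          e (suc (a ℕ.+ i)) (b ℕ.+ j)       ≡⟨ cong (λ k → e k (b ℕ.+ j)) (sym (ℕ.+-suc a i)) ⟩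
          e (a ℕ.+ suc i) (b ℕ.+ j)         ≡⟨ sym (e-* a b (suc i) j) ⟩
          e a b * e (suc i) j               ≡⟨ cong (e a b *_) (sym (ρ₀-neg-e i j)) ⟩
          e a b * ρ₀ (- e i j)              ∎

  ρ₀-nonzero : ∀ x → x ≢ 0# → ρ₀ x ≢ 0#
  ρ₀-nonzero x x≢0 with e-cover x x≢0
  ... | true , i , j , refl = λ ρ₀x≡0 → e-nonzero i (suc j) (-‿injective (trans (sym (ρ₀-e i j)) (trans ρ₀x≡0 (sym -0#≈0#))))
  ... | false , i , j , refl = λ ρ₀x≡0 → e-nonzero (suc i) j (trans (sym (ρ₀-neg-e i j)) ρ₀x≡0)

  ρ₀-reflects-0 : ∀ x → ρ₀ x ≡ 0# → x ≡ 0#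
  ρ₀-reflects-0 x ρ₀x≡0 with x ≟ 0#
  ... | yes x≡0 = x≡0
  ... | no x≢0 = ⊥-elim (ρ₀-nonzero x x≢0 ρ₀x≡0)

  geometric-ε : geometric ε m ≡ 0#
  geometric-ε = *-cancelˡ _ (^-nonzero n>0 ξⁿ≡1 (toℕ j₀)) (begin
    ξ ^ toℕ j₀ * geometric ε m                ≡⟨ cong (ξ ^ toℕ j₀ *_) (sym (sumFin-powers ε m)) ⟩
    ξ ^ toℕ j₀ * sumFin m (λ i → ε ^ toℕ i)   ≡⟨ sumFin-*ˡ m _ _ ⟩
    sumFin m (λ i → ξ ^ toℕ j₀ * ε ^ toℕ i)   ≡⟨ sumFin-cong m (λ i → *-comm _ _) ⟩
    sumFin m (λ i → A i j₀)                   ≡⟨ columns-sum-to-0 j₀ ⟩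
    0#                                        ≡⟨ sym (zeroʳ _) ⟩
    ξ ^ toℕ j₀ * 0#                           ∎)
    where j₀ = fromℕ< n>0

  geometric-ξ : geometric ξ n ≡ 0#
  geometric-ξ = *-cancelˡ _ (^-nonzero m>0 εᵐ≡1 (toℕ i₀)) (begin
    ε ^ toℕ i₀ * geometric ξ n                ≡⟨ cong (ε ^ toℕ i₀ *_) (sym (sumFin-powers ξ n)) ⟩
    ε ^ toℕ i₀ * sumFin n (λ j → ξ ^ toℕ j)   ≡⟨ sumFin-*ˡ n _ _ ⟩
    sumFin n (A i₀)                           ≡⟨ rows-sum-to-0 i₀ ⟩
    0#                                        ≡⟨ sym (zeroʳ _) ⟩
    ε ^ toℕ i₀ * 0#                           ∎)
    where i₀ = fromℕ< m>0

  m≢1 : m ≢ 1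
  m≢1 m≡1 = singleton-sum-nonzero (λ i → A i j₀) m≡1 (λ i → entries-nonzero i j₀) (columns-sum-to-0 j₀)
    where j₀ = fromℕ< n>0

  n≢1 : n ≢ 1
  n≢1 n≡1 = singleton-sum-nonzero (A i₀) n≡1 (entries-nonzero i₀) (rows-sum-to-0 i₀)
    where i₀ = fromℕ< m>0

  n∤m : ¬ n ∣ m
  n∤m n∣m = n≢1 (coprime (n∣m , ∣-refl))

  face-e : ∀ x i j → Face (x , x + e i j) m
  face-e x i j = geometric-face x (e-nonzero i j) ord-ε geometric-ε turn
    where
    turn : ∀ k → ρ₀ (- (e i j * ε ^ k)) ≡ e i j * ε ^ suc k
    turn k = trans (cong (λ z → ρ₀ (- z)) (e-*-ε^ k i j)) (trans (ρ₀-neg-e (k ℕ.+ i) j) (sym (e-*-ε^ (suc k) i j)))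

  face-neg-e : ∀ x i j → Face (x , x + - e i j) n
  face-neg-e x i j = geometric-face x (λ -e≡0 → e-nonzero i j (-‿injective (trans -e≡0 (sym -0#≈0#)))) ord-ξ geometric-ξ turn
    where
    turn : ∀ k → ρ₀ (- (- e i j * ξ ^ k)) ≡ - e i j * ξ ^ suc k
    turn k = begin
      ρ₀ (- (- e i j * ξ ^ k))      ≡⟨ cong ρ₀ (trans (cong -_ (sym (-‿distribˡ-* _ _))) (-‿involutive _)) ⟩
      ρ₀ (e i j * ξ ^ k)            ≡⟨ cong ρ₀ (e-*-ξ^ k i j) ⟩
      ρ₀ (e i (k ℕ.+ j))            ≡⟨ ρ₀-e i (k ℕ.+ j) ⟩
      - e i (suc k ℕ.+ j)           ≡⟨ cong -_ (sym (e-*-ξ^ (suc k) i j)) ⟩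
      - (e i j * ξ ^ suc k)         ≡⟨ -‿distribˡ-* _ _ ⟩
      - e i j * ξ ^ suc k           ∎

  faces : ∀ x y → x ≢ y → Face (x , y) m ⊎ Face (x , y) n
  faces x y x≢y with (y - x) ≟ 0#
  ... | yes y-x≡0 = ⊥-elim (x≢y (sym (trans (sym (x+[y-x]≡y x y)) (trans (cong (x +_) y-x≡0) (+-identityʳ x)))))
  ... | no y-x≢0 with e-cover (y - x) y-x≢0
  ...   | true , i , j , e≡y-x =
          inj₁ (subst (λ z → Face (x , z) m) (trans (cong (x +_) e≡y-x) (x+[y-x]≡y x y)) (face-e x i j))
  ...   | false , i , j , -e≡y-x =
          inj₂ (subst (λ z → Face (x , z) n) (trans (cong (x +_) -e≡y-x) (x+[y-x]≡y x y)) (face-neg-e x i j))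

  e-diagonal : ∀ i j → ∃ λ k → e k k ≡ e i j
  e-diagonal i j with separating-exponent coprime n>0 εᵐ≡1 ξⁿ≡1
                    | separating-exponent (Coprimality.sym coprime) m>0 ξⁿ≡1 εᵐ≡1
  ... | P , εᴾ≡1 , ξᴾ≡ξ | Q , ξQ≡1 , εQ≡ε = Q ℕ.* i ℕ.+ P ℕ.* j , cong₂ _*_ (begin
    ε ^ (Q ℕ.* i ℕ.+ P ℕ.* j)     ≡⟨ linear ε ⟩
    (ε ^ Q) ^ i * (ε ^ P) ^ j     ≡⟨ cong₂ (λ u v → u ^ i * v ^ j) εQ≡ε εᴾ≡1 ⟩
    ε ^ i * 1# ^ j                ≡⟨ cong (ε ^ i *_) (1^k≡1 j) ⟩
    ε ^ i * 1#                    ≡⟨ *-identityʳ _ ⟩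
    ε ^ i                         ∎) (begin
    ξ ^ (Q ℕ.* i ℕ.+ P ℕ.* j)     ≡⟨ linear ξ ⟩
    (ξ ^ Q) ^ i * (ξ ^ P) ^ j     ≡⟨ cong₂ (λ u v → u ^ i * v ^ j) ξQ≡1 ξᴾ≡ξ ⟩
    1# ^ i * ξ ^ j                ≡⟨ cong (_* ξ ^ j) (1^k≡1 i) ⟩
    1# * ξ ^ j                    ≡⟨ *-identityˡ _ ⟩
    ξ ^ j                         ∎)
    where
    linear : ∀ x → x ^ (Q ℕ.* i ℕ.+ P ℕ.* j) ≡ (x ^ Q) ^ i * (x ^ P) ^ j
    linear x = trans (^-distribˡ-+-* x (Q ℕ.* i) (P ℕ.* j)) (sym (cong₂ _*_ (^-*-assoc x Q i) (^-*-assoc x P j)))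

  e-column-periodic : ∀ i j → e i (n ℕ.+ j) ≡ e i j
  e-column-periodic i j = trans (sym (e-*-ξ^ n i j)) (trans (cong (e i j *_) ξⁿ≡1) (*-identityʳ _))

  ρ₀-orbit-of-1 : ∀ k → iter ρ₀ (k ℕ.+ k) 1# ≡ e k k
  ρ₀-orbit-of-1 zero = sym e-0-0
  ρ₀-orbit-of-1 (suc k) = begin
    iter ρ₀ (suc k ℕ.+ suc k) 1#       ≡⟨ cong (λ l → iter ρ₀ (suc l) 1#) (ℕ.+-suc k k) ⟩
    ρ₀ (ρ₀ (iter ρ₀ (k ℕ.+ k) 1#))     ≡⟨ cong (λ x → ρ₀ (ρ₀ x)) (ρ₀-orbit-of-1 k) ⟩
    ρ₀ (ρ₀ (e k k))                    ≡⟨ cong ρ₀ (ρ₀-e k k) ⟩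
    ρ₀ (- e k (suc k))                 ≡⟨ ρ₀-neg-e k (suc k) ⟩
    e (suc k) (suc k)                  ∎

  ρ₀-orbit-covers : ∀ x → x ≢ 0# → ∃ λ l → iter ρ₀ l 1# ≡ x
  ρ₀-orbit-covers x x≢0 with e-cover x x≢0
  ... | true , i , j , eᵢⱼ≡x with e-diagonal i j
  ...   | k , eₖₖ≡eᵢⱼ = k ℕ.+ k , trans (ρ₀-orbit-of-1 k) (trans eₖₖ≡eᵢⱼ eᵢⱼ≡x)
  ρ₀-orbit-covers x x≢0 | false , i , j , -eᵢⱼ≡x with e-diagonal i (n ℕ.∸ 1 ℕ.+ j)
  ...   | k , eₖₖ≡eᵢⱼ′ = suc (k ℕ.+ k) , (begin
    ρ₀ (iter ρ₀ (k ℕ.+ k) 1#)       ≡⟨ cong ρ₀ (ρ₀-orbit-of-1 k) ⟩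
    ρ₀ (e k k)                      ≡⟨ ρ₀-e k k ⟩
    - e k (suc k)                   ≡⟨ cong -_ (sym (ξ*e k k)) ⟩
    - (ξ * e k k)                   ≡⟨ cong (λ y → - (ξ * y)) eₖₖ≡eᵢⱼ′ ⟩
    - (ξ * e i (n ℕ.∸ 1 ℕ.+ j))     ≡⟨ cong -_ (ξ*e i (n ℕ.∸ 1 ℕ.+ j)) ⟩
    - e i (suc (n ℕ.∸ 1) ℕ.+ j)     ≡⟨ cong (λ l → - e i (l ℕ.+ j)) (ℕ.m+[n∸m]≡n {1} n>0) ⟩
    - e i (n ℕ.+ j)                 ≡⟨ cong -_ (e-column-periodic i j) ⟩
    - e i j                         ≡⟨ -eᵢⱼ≡x ⟩
    x                               ∎)

  g : F
  g = ε * ξ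

  g^k≡e : ∀ k → g ^ k ≡ e k k
  g^k≡e = ^-distribʳ-* ε ξ

  instance
    mn-nonZero : ℕ.NonZero (m ℕ.* n)
    mn-nonZero = ℕ.m*n≢0 m n

  g-order : HasOrder g (m ℕ.* n)
  g-order = ℕ.>-nonZero⁻¹ (m ℕ.* n) , gᵐⁿ≡1 , minimal
    where
    gᵐⁿ≡1 : g ^ (m ℕ.* n) ≡ 1#
    gᵐⁿ≡1 = begin
      g ^ (m ℕ.* n)                  ≡⟨ g^k≡e (m ℕ.* n) ⟩
      ε ^ (m ℕ.* n) * ξ ^ (m ℕ.* n)  ≡⟨ cong₂ _*_ (^-*-≡1 m εᵐ≡1 n) (trans (cong (ξ ^_) (ℕ.*-comm m n)) (^-*-≡1 n ξⁿ≡1 m)) ⟩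
      1# * 1#                        ≡⟨ *-identityˡ 1# ⟩
      1#                             ∎
    minimal : ∀ d → 0 ℕ.< d → d ℕ.< m ℕ.* n → g ^ d ≢ 1#
    minimal d d>0 d<mn gᵈ≡1 = ℕ.<⇒≱ d<mn (∣⇒≤ {{ℕ.>-nonZero d>0}} mn∣d)
      where
      same-entry : d mod m ≡ 0 mod m × d mod n ≡ 0 mod n
      same-entry = e-injective (trans (sym (g^k≡e d)) (trans gᵈ≡1 (sym e-0-0)))
      mn∣d : m ℕ.* n ∣ d
      mn∣d = subst (_∣ d) (coprime⇒lcm≡* coprime) (lcm-least (mod≡0⇒∣ (proj₁ same-entry)) (mod≡0⇒∣ (proj₂ same-entry)))

  face-0-1 : Face (0# , 1#) m
  face-0-1 = subst (λ z → Face (0# , z) m) (trans (+-identityˡ _) e-0-0) (face-e 0# 0 0)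

  face-0-neg1 : Face (0# , - 1#) n
  face-0-neg1 = subst (λ z → Face (0# , z) n) (trans (+-identityˡ _) (cong -_ e-0-0)) (face-neg-e 0# 0 0)

  face-1-0 : Face (1# , 0#) n
  face-1-0 = subst (λ z → Face (1# , z) n) (trans (cong (λ w → 1# - w) e-0-0) (-‿inverseʳ 1#)) (face-neg-e 1# 0 0)

  affine : ℕ → F → F → F
  affine k t x = g ^ k * x + t

  affine-IsAut : ∀ k t → IsAut m n A (affine k t)
  affine-IsAut k t =
    affine-bijective t (^-nonzero (proj₁ g-order) (proj₁ (proj₂ g-order)) k) ,
    inj₁ (λ x y _ → sym (rot-affine ρ₀-scale-gᵏ t x y))
    where
    ρ₀-scale-gᵏ : ∀ x → ρ₀ (g ^ k * x) ≡ g ^ k * ρ₀ x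
    ρ₀-scale-gᵏ x = subst (λ c → ρ₀ (c * x) ≡ c * ρ₀ x) (sym (g^k≡e k)) (ρ₀-scale k k x)

  commuting-fixing-1 : ∀ {τ} → Commutes τ → τ 0# ≡ 0# → τ 1# ≡ 1# → ∀ x → x ≢ 0# → τ x ≡ x
  commuting-fixing-1 {τ} τ-commutes τ0≡0 τ1≡1 =
    orbit-induction ρ₀-nonzero ρ₀-orbit-covers (λ x → τ x ≡ x) τ1≡1 (λ x x≢0 τx≡x → begin
      τ (ρ₀ x)            ≡⟨ cong τ (sym (rot-origin x)) ⟩
      τ (Rot 0# x)        ≡⟨ τ-commutes 0# x (λ 0≡x → x≢0 (sym 0≡x)) ⟩
      Rot (τ 0#) (τ x)    ≡⟨ cong₂ Rot τ0≡0 τx≡x ⟩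
      Rot 0# x            ≡⟨ rot-origin x ⟩
      ρ₀ x                ∎)

  commuting-negating-1 : ∀ {τ} → Commutes τ → τ 0# ≡ 0# → τ 1# ≢ - 1#
  commuting-negating-1 {τ} τ-commutes τ0≡0 τ1≡-1 =
    n∤m (face-period-divides face-0-neg1 n>0 (begin
      iter step m (0# , - 1#)      ≡⟨ cong₂ (λ u v → iter step m (u , v)) (sym τ0≡0) (sym τ1≡-1) ⟩
      iter step m (τ 0# , τ 1#)    ≡⟨ iter-commutes ρ₀-reflects-0 τ-commutes m 0≢1 ⟩
      map τ τ (iter step m (0# , 1#)) ≡⟨ cong (map τ τ) (proj₁ face-0-1) ⟩
      (τ 0# , τ 1#)                ≡⟨ cong₂ _,_ τ0≡0 τ1≡-1 ⟩
      (0# , - 1#)                  ∎))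

  reversing-fixing-1 : ∀ {τ} → Reverses τ → τ 0# ≡ 0# → τ 1# ≢ 1#
  reversing-fixing-1 {τ} τ-reverses τ0≡0 τ1≡1 =
    n∤m (face-period-divides face-1-0 n>0 (begin
      iter step m (1# , 0#)        ≡⟨ cong₂ (λ u v → iter step m (u , v)) (sym τ1≡1) (sym τ0≡0) ⟩
      iter step m (τ 1# , τ 0#)    ≡⟨ cong (λ p → iter step m (swap (map τ τ p))) (sym (proj₁ face-0-1)) ⟩
      iter step m (swap (map τ τ (iter step m (0# , 1#)))) ≡⟨ iter-reverses ρ₀-reflects-0 τ-reverses m 0≢1 ⟩
      (τ 1# , τ 0#)                ≡⟨ cong₂ _,_ τ1≡1 τ0≡0 ⟩
      (1# , 0#)                    ∎))

  ρ₀-preimage-of-e : ∀ {v} i j → ρ₀ v ≡ e i j → ε * v ≡ - e i j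
  ρ₀-preimage-of-e {v} i j ρ₀v≡e with v ≟ 0#
  ... | yes refl = ⊥-elim (e-nonzero i j (trans (sym ρ₀v≡e) ρ₀-0))
  ... | no v≢0 with e-cover v v≢0
  ...   | true , a , b , refl = ⊥-elim (e≢-e i j a (suc b) (trans (sym ρ₀v≡e) (ρ₀-e a b)))
  ...   | false , a , b , refl = begin
          ε * - e a b            ≡⟨ sym (-‿distribʳ-* ε _) ⟩
          - (ε * e a b)          ≡⟨ cong -_ (sym (*-assoc ε _ _)) ⟩
          - e (suc a) b          ≡⟨ cong -_ (trans (sym (ρ₀-neg-e a b)) ρ₀v≡e) ⟩
          - e i j                ∎

  ρ₀-preimage-of-neg-e : ∀ {v} i j → ρ₀ v ≡ - e i j → ξ * v ≡ e i j
  ρ₀-preimage-of-neg-e {v} i j ρ₀v≡-e with v ≟ 0#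
  ... | yes refl = ⊥-elim (e-nonzero i j (-‿injective (trans (sym ρ₀v≡-e) (trans ρ₀-0 (sym -0#≈0#)))))
  ... | no v≢0 with e-cover v v≢0
  ...   | true , a , b , refl = trans (ξ*e a b) (-‿injective (trans (sym (ρ₀-e a b)) ρ₀v≡-e))
  ...   | false , a , b , refl = ⊥-elim (e≢-e (suc a) b i j (trans (sym (ρ₀-neg-e a b)) ρ₀v≡-e))

  ρ₀-swap-e : ∀ i j a b → ρ₀ (e i j) * e a b ≡ e i j * ρ₀ (e a b)
  ρ₀-swap-e i j a b = begin
    ρ₀ (e i j) * e a b             ≡⟨ cong (_* e a b) (ρ₀-e i j) ⟩
    - e i (suc j) * e a b          ≡⟨ sym (-‿distribˡ-* _ _) ⟩
    - (e i (suc j) * e a b)        ≡⟨ cong -_ (e-* i (suc j) a b) ⟩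
    - e (i ℕ.+ a) (suc j ℕ.+ b)    ≡⟨ cong (λ l → - e (i ℕ.+ a) l) (sym (ℕ.+-suc j b)) ⟩
    - e (i ℕ.+ a) (j ℕ.+ suc b)    ≡⟨ cong -_ (sym (e-* i j a (suc b))) ⟩
    - (e i j * e a (suc b))        ≡⟨ -‿distribʳ-* _ _ ⟩
    e i j * - e a (suc b)          ≡⟨ cong (e i j *_) (sym (ρ₀-e a b)) ⟩
    e i j * ρ₀ (e a b)             ∎

  ρ₀-swap-neg-e : ∀ i j a b → ρ₀ (- e i j) * - e a b ≡ - e i j * ρ₀ (- e a b)
  ρ₀-swap-neg-e i j a b = begin
    ρ₀ (- e i j) * - e a b         ≡⟨ cong (_* - e a b) (ρ₀-neg-e i j) ⟩
    e (suc i) j * - e a b          ≡⟨ sym (-‿distribʳ-* _ _) ⟩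
    - (e (suc i) j * e a b)        ≡⟨ cong -_ (e-* (suc i) j a b) ⟩
    - e (suc i ℕ.+ a) (j ℕ.+ b)    ≡⟨ cong (λ l → - e l (j ℕ.+ b)) (sym (ℕ.+-suc i a)) ⟩
    - e (i ℕ.+ suc a) (j ℕ.+ b)    ≡⟨ cong -_ (sym (e-* i j (suc a) b)) ⟩
    - (e i j * e (suc a) b)        ≡⟨ -‿distribˡ-* _ _ ⟩
    - e i j * e (suc a) b          ≡⟨ cong (- e i j *_) (sym (ρ₀-neg-e a b)) ⟩
    - e i j * ρ₀ (- e a b)         ∎

  -- ρ₀ flips the sign of ± e i j, so x * ρ₀ w ≡ - e 0 0 forces x and w to have the same sign, where the two products agree.
  ρ₀-transfer : ∀ {x w} → x ≢ 0# → x * ρ₀ w ≡ - 1# → ρ₀ x * w ≡ - 1#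
  ρ₀-transfer {x} {w} x≢0 xρ₀w≡-1 with w ≟ 0#
  ... | yes refl = ⊥-elim (-1≢0 (trans (sym xρ₀w≡-1) (trans (cong (x *_) ρ₀-0) (zeroʳ x))))
  ... | no w≢0 with e-cover x x≢0 | e-cover w w≢0
  ... | true , i , j , refl | true , a , b , refl = trans (ρ₀-swap-e i j a b) xρ₀w≡-1
  ... | false , i , j , refl | false , a , b , refl = trans (ρ₀-swap-neg-e i j a b) xρ₀w≡-1
  ... | true , i , j , refl | false , a , b , refl = ⊥-elim (e≢-e (i ℕ.+ suc a) (j ℕ.+ b) 0 0 (begin
        e (i ℕ.+ suc a) (j ℕ.+ b)      ≡⟨ sym (e-* i j (suc a) b) ⟩
        e i j * e (suc a) b            ≡⟨ cong (e i j *_) (sym (ρ₀-neg-e a b)) ⟩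
        e i j * ρ₀ (- e a b)           ≡⟨ xρ₀w≡-1 ⟩
        - 1#                           ≡⟨ cong -_ (sym e-0-0) ⟩
        - e 0 0                        ∎))
  ... | false , i , j , refl | true , a , b , refl = ⊥-elim (e≢-e (i ℕ.+ a) (j ℕ.+ suc b) 0 0 (begin
        e (i ℕ.+ a) (j ℕ.+ suc b)      ≡⟨ sym (e-* i j a (suc b)) ⟩
        e i j * e a (suc b)            ≡⟨ neg-neg (e i j) _ ⟩
        - e i j * - e a (suc b)        ≡⟨ cong (- e i j *_) (sym (ρ₀-e a b)) ⟩
        - e i j * ρ₀ (e a b)           ≡⟨ xρ₀w≡-1 ⟩
        - 1#                           ≡⟨ cong -_ (sym e-0-0) ⟩
        - e 0 0                        ∎))
    where
    neg-neg : ∀ u v → u * v ≡ - u * - v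
    neg-neg = solve 2 (λ u v → u :* v := (:- u) :* (:- v)) refl

  module _ {τ} (τ-reverses : Reverses τ) (τ0≡0 : τ 0# ≡ 0#) (τ1≡-1 : τ 1# ≡ - 1#) where

    reversing-inversion : ∀ x → x ≢ 0# → x * τ x ≡ - 1#
    reversing-inversion = orbit-induction ρ₀-nonzero ρ₀-orbit-covers (λ x → x * τ x ≡ - 1#)
      (trans (*-identityˡ _) τ1≡-1) (λ x x≢0 xτx≡-1 → ρ₀-transfer x≢0 (trans (cong (x *_) (undo-turn x x≢0)) xτx≡-1))
      where
      undo-turn : ∀ y → y ≢ 0# → ρ₀ (τ (ρ₀ y)) ≡ τ y
      undo-turn y y≢0 = begin
        ρ₀ (τ (ρ₀ y))               ≡⟨ sym (rot-origin _) ⟩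
        Rot 0# (τ (ρ₀ y))           ≡⟨ cong₂ (λ u v → Rot u (τ v)) (sym τ0≡0) (sym (rot-origin y)) ⟩
        Rot (τ 0#) (τ (Rot 0# y))   ≡⟨ τ-reverses 0# y (λ 0≡y → y≢0 (sym 0≡y)) ⟩
        τ y                         ∎

    reversing-ε³≡1 : ε ^ 3 ≡ 1#
    reversing-ε³≡1 = cube-root-of-unity [1+ε]z≡-1 ε[z+1]≡-1
      where
      Rot-1-0 : Rot 1# 0# ≡ 1# + ε
      Rot-1-0 = cong (1# +_) (trans (cong ρ₀ (trans (+-identityˡ _) (cong -_ (sym e-0-0)))) (trans (ρ₀-neg-e 0 0) e-1-0))
      z : F
      z = τ (Rot 1# 0#)
      [1+ε]z≡-1 : (1# + ε) * z ≡ - 1#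
      [1+ε]z≡-1 = subst (λ u → u * z ≡ - 1#) Rot-1-0 (reversing-inversion (Rot 1# 0#) Rot-1-0≢0)
        where
        Rot-1-0≢0 : Rot 1# 0# ≢ 0#
        Rot-1-0≢0 eq = e≢-e 1 0 0 0 (begin
          e 1 0           ≡⟨ solve 1 (λ u → u := (con 1ℤ :+ u) :- con 1ℤ) refl (e 1 0) ⟩
          (1# + e 1 0) - 1# ≡⟨ cong (λ u → (1# + u) - 1#) e-1-0 ⟩
          (1# + ε) - 1#   ≡⟨ cong (_- 1#) (trans (sym Rot-1-0) eq) ⟩
          0# - 1#         ≡⟨ trans (+-identityˡ _) (cong -_ (sym e-0-0)) ⟩
          - e 0 0         ∎)
      ε[z+1]≡-1 : ε * (z + 1#) ≡ - 1#
      ε[z+1]≡-1 = begin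
        ε * (z + 1#)        ≡⟨ cong (ε *_) (solve 1 (λ z → z :+ con 1ℤ := z :- (:- con 1ℤ)) refl z) ⟩
        ε * (z - - 1#)      ≡⟨ ρ₀-preimage-of-e 0 0 (trans (rot≡0 Rot-τ1-z≡0) (trans (-‿involutive 1#) (sym e-0-0))) ⟩
        - e 0 0             ≡⟨ cong -_ e-0-0 ⟩
        - 1#                ∎
        where
        Rot-τ1-z≡0 : Rot (- 1#) z ≡ 0#
        Rot-τ1-z≡0 = trans (cong (λ u → Rot u z) (sym τ1≡-1)) (trans (τ-reverses 1# 0# 1≢0) τ0≡0)

    reversing-ξ³≡1 : ξ ^ 3 ≡ 1#
    reversing-ξ³≡1 = cube-root-of-unity [1+ξ][-z]≡-1 ξ[-z+1]≡-1
      where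
      τ-1≡1 : τ (- 1#) ≡ 1#
      τ-1≡1 = begin
        τ (- 1#)                  ≡⟨ solve 1 (λ w → w := :- ((:- con 1ℤ) :* w)) refl (τ (- 1#)) ⟩
        - (- 1# * τ (- 1#))       ≡⟨ cong -_ (reversing-inversion (- 1#) -1≢0) ⟩
        - - 1#                    ≡⟨ -‿involutive 1# ⟩
        1#                        ∎
      Rot-neg1-0 : Rot (- 1#) 0# ≡ - 1# - ξ
      Rot-neg1-0 = cong (- 1# +_) (trans (cong ρ₀ (trans (+-identityˡ _) (trans (-‿involutive 1#) (sym e-0-0))))
                                         (trans (ρ₀-e 0 0) (cong -_ e-0-1)))
      z : F
      z = τ (Rot (- 1#) 0#)
      [-1-ξ]z≡-1 : (- 1# - ξ) * z ≡ - 1#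
      [-1-ξ]z≡-1 = subst (λ u → u * z ≡ - 1#) Rot-neg1-0 (reversing-inversion (Rot (- 1#) 0#) Rot-neg1-0≢0)
        where
        Rot-neg1-0≢0 : Rot (- 1#) 0# ≢ 0#
        Rot-neg1-0≢0 eq = e≢-e 0 1 0 0 (begin
          e 0 1               ≡⟨ e-0-1 ⟩
          ξ                   ≡⟨ solve 1 (λ x → x := :- ((:- con 1ℤ :- x) :+ con 1ℤ)) refl ξ ⟩
          - ((- 1# - ξ) + 1#) ≡⟨ cong (λ u → - (u + 1#)) (trans (sym Rot-neg1-0) eq) ⟩
          - (0# + 1#)         ≡⟨ cong -_ (trans (+-identityˡ 1#) (sym e-0-0)) ⟩
          - e 0 0             ∎)
      ξ[z-1]≡1 : ξ * (z - 1#) ≡ 1#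
      ξ[z-1]≡1 = trans (ρ₀-preimage-of-neg-e 0 0 (trans (rot≡0 Rot-1-z≡0) (cong -_ (sym e-0-0)))) e-0-0
        where
        Rot-1-z≡0 : Rot 1# z ≡ 0#
        Rot-1-z≡0 = trans (cong (λ u → Rot u z) (sym τ-1≡1)) (trans (τ-reverses (- 1#) 0# -1≢0) τ0≡0)
      [1+ξ][-z]≡-1 : (1# + ξ) * - z ≡ - 1#
      [1+ξ][-z]≡-1 = trans (solve 2 (λ x z → (con 1ℤ :+ x) :* (:- z) := (:- con 1ℤ :- x) :* z) refl ξ z) [-1-ξ]z≡-1
      ξ[-z+1]≡-1 : ξ * (- z + 1#) ≡ - 1#
      ξ[-z+1]≡-1 = trans (solve 2 (λ x z → x :* (:- z :+ con 1ℤ) := :- (x :* (z :- con 1ℤ))) refl ξ z) (cong -_ ξ[z-1]≡1)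

  reversing-negating-1 : ∀ {τ} → Reverses τ → τ 0# ≡ 0# → τ 1# ≢ - 1#
  reversing-negating-1 τ-reverses τ0≡0 τ1≡-1 = m≢1 (coprime (∣-refl , subst (m ∣_) (trans m≡3 (sym n≡3)) ∣-refl))
    where
    m≡3 : m ≡ 3
    m≡3 = odd-order-of-cube-root ord-ε odd-m m≢1 (reversing-ε³≡1 τ-reverses τ0≡0 τ1≡-1)
    n≡3 : n ≡ 3
    n≡3 = odd-order-of-cube-root ord-ξ odd-n n≢1 (reversing-ξ³≡1 τ-reverses τ0≡0 τ1≡-1)

  module Normalised (σ : F → F) (σ-aut : IsAut m n A σ) where
    t : F
    t = σ 0#

    σ1-t≢0 : σ 1# - t ≢ 0#
    σ1-t≢0 σ1-t≡0 = 1≢0 (proj₁ (proj₁ σ-aut) (begin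
      σ 1#               ≡⟨ sym (x+[y-x]≡y t (σ 1#)) ⟩
      t + (σ 1# - t)     ≡⟨ cong (t +_) σ1-t≡0 ⟩
      t + 0#             ≡⟨ +-identityʳ t ⟩
      σ 0#               ∎))

    s : Bool
    s = proj₁ (e-cover (σ 1# - t) σ1-t≢0)

    i j : ℕ
    i = proj₁ (proj₂ (e-cover (σ 1# - t) σ1-t≢0))
    j = proj₁ (proj₂ (proj₂ (e-cover (σ 1# - t) σ1-t≢0)))

    c c⁻¹ : F
    c = e i j
    c⁻¹ = proj₁ (inv c (e-nonzero i j))

    c*c⁻¹ : c * c⁻¹ ≡ 1#
    c*c⁻¹ = proj₂ (inv c (e-nonzero i j))

    τ : F → F
    τ x = c⁻¹ * (σ x - t)

    σ≐cτ+t : ∀ x → σ x ≡ c * τ x + t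
    σ≐cτ+t x = sym (begin
      c * (c⁻¹ * (σ x - t)) + t   ≡⟨ cong (_+ t) (sym (*-assoc c c⁻¹ _)) ⟩
      (c * c⁻¹) * (σ x - t) + t   ≡⟨ cong (λ u → u * (σ x - t) + t) c*c⁻¹ ⟩
      1# * (σ x - t) + t          ≡⟨ solve 2 (λ y t → con 1ℤ :* (y :- t) :+ t := y) refl (σ x) t ⟩
      σ x                         ∎)

    τ0≡0 : τ 0# ≡ 0#
    τ0≡0 = trans (cong (c⁻¹ *_) (-‿inverseʳ t)) (zeroʳ c⁻¹)

    τ1≡±1 : τ 1# ≡ signed s 1#
    τ1≡±1 = trans (cong (c⁻¹ *_) (sym (proj₂ (proj₂ (proj₂ (e-cover (σ 1# - t) σ1-t≢0)))))) (unsign s)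
      where
      c⁻¹*c : c⁻¹ * c ≡ 1#
      c⁻¹*c = trans (*-comm c⁻¹ c) c*c⁻¹
      unsign : ∀ b → c⁻¹ * signed b c ≡ signed b 1#
      unsign true = c⁻¹*c
      unsign false = trans (sym (-‿distribʳ-* c⁻¹ c)) (cong -_ c⁻¹*c)

    c≡gᵏ : ∃ λ (k : Fin (m ℕ.* n)) → g ^ toℕ k ≡ c
    c≡gᵏ = k₀ mod (m ℕ.* n) , trans (^-mod (m ℕ.* n) (proj₁ (proj₂ g-order)) k₀) (trans (g^k≡e k₀) eₖ₀ₖ₀≡c)
      where
      k₀ : ℕ
      k₀ = proj₁ (e-diagonal i j)
      eₖ₀ₖ₀≡c : e k₀ k₀ ≡ c
      eₖ₀ₖ₀≡c = proj₂ (e-diagonal i j)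

  Affine : (F → F) → Set
  Affine σ = ∃ λ (k : Fin (m ℕ.* n)) → ∀ x → σ x ≡ g ^ toℕ k * x + σ 0#

  automorphism-affine : ∀ σ → IsAut m n A σ → Affine σ
  automorphism-affine σ σ-aut = classify s τ1≡±1 (proj₂ σ-aut)
    where
    open Normalised σ σ-aut
    c≢0 : c ≢ 0#
    c≢0 = e-nonzero i j
    classify : ∀ b → τ 1# ≡ signed b 1# → Commutes σ ⊎ Reverses σ → Affine σ
    classify true τ1≡1 (inj₁ σ-commutes) = proj₁ c≡gᵏ , λ x →
      trans (affine-on-nonzero σ c (λ y y≢0 → trans (σ≐cτ+t y) (cong (λ u → c * u + t) (τ-fixes y y≢0))) x)
            (cong (λ u → u * x + t) (sym (proj₂ c≡gᵏ)))
      where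
      τ-fixes : ∀ x → x ≢ 0# → τ x ≡ x
      τ-fixes = commuting-fixing-1 (commutes-unscale c≢0 (ρ₀-scale i j) σ≐cτ+t σ-commutes) τ0≡0 τ1≡1
    classify false τ1≡-1 (inj₁ σ-commutes) =
      ⊥-elim (commuting-negating-1 (commutes-unscale c≢0 (ρ₀-scale i j) σ≐cτ+t σ-commutes) τ0≡0 τ1≡-1)
    classify true τ1≡1 (inj₂ σ-reverses) =
      ⊥-elim (reversing-fixing-1 (reverses-unscale c≢0 (ρ₀-scale i j) σ≐cτ+t σ-reverses) τ0≡0 τ1≡1)
    classify false τ1≡-1 (inj₂ σ-reverses) =
      ⊥-elim (reversing-negating-1 (reverses-unscale c≢0 (ρ₀-scale i j) σ≐cτ+t σ-reverses) τ0≡0 τ1≡-1)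

  Aut₀-cyclic : CyclicIso (m ℕ.* n) (IsAut₀ m n A)
  Aut₀-cyclic = record
    { φ = φ
    ; φ∈ = λ k → IsAut-resp-≐ (λ x → +-identityʳ _) (affine-IsAut (toℕ k) 0#) , zeroʳ _
    ; hom = hom
    ; inj = λ i j φi≐φj → Fin.toℕ-injective (order-pow-injective g-order (Fin.toℕ<n i) (Fin.toℕ<n j)
              (trans (sym (*-identityʳ _)) (trans (φi≐φj 1#) (*-identityʳ _))))
    ; surj = λ σ (σ-aut , σ0≡0) → linear (automorphism-affine σ σ-aut) σ0≡0
    }
    where
    φ : Fin (m ℕ.* n) → F → F
    φ k x = g ^ toℕ k * x
    linear : ∀ {σ} → Affine σ → σ 0# ≡ 0# → ∃ λ k → φ k ≐ σ
    linear (k , σ≐) σ0≡0 = k , λ x → sym (trans (σ≐ x) (trans (cong (g ^ toℕ k * x +_) σ0≡0) (+-identityʳ _)))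
    hom : ∀ i j k → (toℕ i ℕ.+ toℕ j ≡ toℕ k) ⊎ (toℕ i ℕ.+ toℕ j ≡ toℕ k ℕ.+ m ℕ.* n) → φ k ≐ (λ x → φ i (φ j x))
    hom i j k i+j≡k x = begin
      g ^ toℕ k * x                    ≡⟨ cong (_* x) (sym (exponent-wraps i+j≡k)) ⟩
      g ^ (toℕ i ℕ.+ toℕ j) * x        ≡⟨ cong (_* x) (^-distribˡ-+-* g (toℕ i) (toℕ j)) ⟩
      (g ^ toℕ i * g ^ toℕ j) * x      ≡⟨ *-assoc _ _ _ ⟩
      g ^ toℕ i * (g ^ toℕ j * x)      ∎
      where
      exponent-wraps : ∀ {a b} → (a ≡ b) ⊎ (a ≡ b ℕ.+ m ℕ.* n) → g ^ a ≡ g ^ b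
      exponent-wraps (inj₁ refl) = refl
      exponent-wraps {b = b} (inj₂ refl) = trans (^-distribˡ-+-* g b _)
        (trans (cong (g ^ b *_) (proj₁ (proj₂ g-order))) (*-identityʳ _))

  Aut-card : HasCard (IsAut m n A) (size ℕ.* (m ℕ.* n))
  Aut-card = HasCard-via-↔ K (↔-trans (enum ×-↔ ↔-refl) (↔-sym Fin.*↔×)) (λ (t , k) → affine (toℕ k) t)
    (λ (t , k) → affine-IsAut (toℕ k) t) injective
    (λ σ σ-aut → (σ 0# , proj₁ (automorphism-affine σ σ-aut)) , λ x → sym (proj₂ (automorphism-affine σ σ-aut) x))
    where
    injective : ∀ p q → affine (toℕ (proj₂ p)) (proj₁ p) ≐ affine (toℕ (proj₂ q)) (proj₁ q) → p ≡ q
    injective (t , k) (t′ , k′) same = cong₂ _,_ t≡t′ (Fin.toℕ-injective (order-pow-injective g-order (Fin.toℕ<n k) (Fin.toℕ<n k′) gᵏ≡gᵏ′))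
      where
      at0 : ∀ l u → affine l u 0# ≡ u
      at0 l u = trans (cong (_+ u) (zeroʳ _)) (+-identityˡ u)
      t≡t′ : t ≡ t′
      t≡t′ = trans (sym (at0 (toℕ k) t)) (trans (same 0#) (at0 (toℕ k′) t′))
      gᵏ≡gᵏ′ : g ^ toℕ k ≡ g ^ toℕ k′
      gᵏ≡gᵏ′ = trans (sym (*-identityʳ _)) (trans (+-cancelʳ t (trans (same 1#) (cong (_ +_) (sym t≡t′)))) (*-identityʳ _))

open import Data.Nat using (_*_; _<_)
open import Data.Nat.Combinatorics using (_C_)

theorem3p8 : (K : FiniteField) (m n : ℕ)
  → 0 < m → 0 < n → Odd m → Odd n → Coprime m n
  → FiniteField.size K ≡ suc (2 * m * n)
  → (ξ ε : FiniteField.F K)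
  → FiniteField.HasOrder K ξ n
  → FiniteField.HasOrder K ε m
  → Embedding.IsHeffter K m n (Embedding.arrayA K ε ξ)
  → Embedding.CyclicIso K (m * n) (Embedding.IsAut₀ K m n (Embedding.arrayA K ε ξ))
    × Embedding.HasCard K (Embedding.IsAut K m n (Embedding.arrayA K ε ξ)) (suc (2 * m * n) C 2)
    × (∀ x y → x ≢ y
         → Embedding.FaceIsSimpleCycleOfLength K m n (Embedding.arrayA K ε ξ) (x , y) m
           ⊎ Embedding.FaceIsSimpleCycleOfLength K m n (Embedding.arrayA K ε ξ) (x , y) n)
    × (∃ λ x → ∃ λ y → x ≢ y
         × Embedding.FaceIsSimpleCycleOfLength K m n (Embedding.arrayA K ε ξ) (x , y) m)
    × (∃ λ x → ∃ λ y → x ≢ y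
         × Embedding.FaceIsSimpleCycleOfLength K m n (Embedding.arrayA K ε ξ) (x , y) n)
theorem3p8 K m n m>0 n>0 odd-m odd-n coprime size≡q ξ ε ord-ξ ord-ε heffter =
  Aut₀-cyclic , subst (HasCard _) |Aut|≡qC2 Aut-card , faces ,
  (0# , 1# , 0≢1 , face-0-1) , (0# , - 1# , (λ 0≡-1 → -1≢0 (sym 0≡-1)) , face-0-neg1)
  where
  open ArchdeaconEmbedding K m n m>0 n>0 odd-m odd-n coprime ξ ε ord-ξ ord-ε heffter
  open FieldProperties K using (0#; 1#; -_; 0≢1; -1≢0; size)
  open Embedding K using (HasCard)
  |Aut|≡qC2 : size * (m * n) ≡ suc (2 * m * n) C 2
  |Aut|≡qC2 = begin
    size * (m * n)                ≡⟨ cong (_* (m * n)) size≡q ⟩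
    suc (2 * m * n) * (m * n)     ≡⟨ cong (λ k → suc k * (m * n)) (ℕ.*-assoc 2 m n) ⟩
    suc (2 * (m * n)) * (m * n)   ≡⟨ sym (BinomialTwo.[1+2x]C2 (m * n)) ⟩
    suc (2 * (m * n)) C 2         ≡⟨ cong (λ k → suc k C 2) (sym (ℕ.*-assoc 2 m n)) ⟩
    suc (2 * m * n) C 2           ∎
    where open ≡-Reasoning
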